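{- Let $G$ be a graph of order $n$ such that $G$ is not isomorphic to $K_3 \cup (n-3)K_1$ (when $n \geq 3$) and $G$ is not isomorphic to $K_3 \cup K_2 \cup (n-5)K_1$ (when $n \geq 5$). Then the maximum number of pairwise edge-disjoint edge-pairs in $G$ equals $\left\lfloor \frac{|E(G)|}{2} \right\rfloor$ if $|E(G)| \geq 2\Delta(G)$, and equals $|E(G)|-\Delta(G)$ if $|E(G)| < 2\Delta(G)$.
   Context: All graphs are finite, simple and undirected. $\Delta(G)$ denotes the maximum degree of $G$. An edge-pair is a set of two independent edges, i.e., two edges sharing no common vertex. Edge-pairs are edge-disjoint if, as sets of edges, they are pairwise disjoint. $K_m$ is the complete graph of order $m$, $G_1 \cup G_2$ is the vertex-disjoint union of graphs, and $mK_1$ is the edgeless graph on $m$ vertices. -}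

module Defs where

open import Data.Nat using (ℕ; zero; suc; _+_; _*_; _∸_; _≤_; _<_; _⊔_)
open import Data.Fin using (Fin; toℕ)
open import Data.Bool using (Bool; true; false; _∧_)
open import Data.List using (List; []; _∷_; length; filter; map; foldr; allFin; concatMap; cartesianProduct; concat)
open import Data.List.Relation.Unary.All using (All)
open import Data.List.Relation.Unary.Unique.Propositional using (Unique)
open import Data.Product using (Σ; _×_; _,_; proj₁; proj₂; ∃)
open import Relation.Binary.PropositionalEquality using (_≡_; _≢_; refl)
open import Relation.Nullary using (¬_)
open import Relation.Nullary.Decidable using (⌊_⌋)
open import Data.Nat.Properties using (_<?_)
open import Data.Fin.Permutation using (Permutation′; _⟨$⟩ʳ_)

record Graph (n : ℕ) : Set where
  field
    adj    : Fin n → Fin n → Bool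
    sym    : ∀ i j → adj i j ≡ adj j i
    irrefl : ∀ i → adj i i ≡ false
open Graph public

pairs : (n : ℕ) → List (Fin n × Fin n)
pairs n = cartesianProduct (allFin n) (allFin n)

isEdge : ∀ {n} → Graph n → Fin n × Fin n → Bool
isEdge G (i , j) = ⌊ toℕ i <? toℕ j ⌋ ∧ adj G i j

numEdges : ∀ {n} → Graph n → ℕ
numEdges {n} G = length (filter (λ p → isEdge G p ≡? true) (pairs n))
  where
  open import Data.Bool.Properties using () renaming (_≟_ to _≡?_)

degree : ∀ {n} → Graph n → Fin n → ℕ
degree {n} G i = length (filter (λ j → adj G i j ≡? true) (allFin n))
  where
  open import Data.Bool.Properties using () renaming (_≟_ to _≡?_)

-- Δ(G): maximum degree (0 for the graph with no vertices).
maxDegree : ∀ {n} → Graph n → ℕ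
maxDegree {n} G = foldr _⊔_ 0 (map (degree G) (allFin n))

IsEdge : ∀ {n} → Graph n → Fin n × Fin n → Set
IsEdge G (i , j) = (toℕ i < toℕ j) × (adj G i j ≡ true)

Independent : ∀ {n} → Fin n × Fin n → Fin n × Fin n → Set
Independent (a , b) (c , d) = (a ≢ c) × (a ≢ d) × (b ≢ c) × (b ≢ d)

IsEdgePair : ∀ {n} → Graph n → (Fin n × Fin n) × (Fin n × Fin n) → Set
IsEdgePair G (e , f) = IsEdge G e × IsEdge G f × Independent e f

edgesOf : ∀ {n} → List ((Fin n × Fin n) × (Fin n × Fin n)) → List (Fin n × Fin n)
edgesOf [] = []
edgesOf ((e , f) ∷ ps) = e ∷ f ∷ edgesOf ps

-- Pairwise edge-disjointness (and distinctness of the pairs) is expressed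
-- by requiring all edges occurring in the family to be distinct.
IsDisjointFamily : ∀ {n} → Graph n → List ((Fin n × Fin n) × (Fin n × Fin n)) → Set
IsDisjointFamily G ps = All (IsEdgePair G) ps × Unique (edgesOf ps)

IsMaxEdgePairNumber : ∀ {n} → Graph n → ℕ → Set
IsMaxEdgePairNumber G k =
  (Σ _ λ ps → IsDisjointFamily G ps × length ps ≡ k) ×
  (∀ ps → IsDisjointFamily G ps → length ps ≤ k)

_≅_ : ∀ {n} → Graph n → Graph n → Set
_≅_ {n} G H = Σ (Permutation′ n) λ π → ∀ i j → adj G i j ≡ adj H (π ⟨$⟩ʳ i) (π ⟨$⟩ʳ j)

tri : ℕ → ℕ → Bool
tri 0 1 = true
tri 0 2 = true
tri 1 0 = true
tri 1 2 = true
tri 2 0 = true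
tri 2 1 = true
tri _ _ = false

triEdge : ℕ → ℕ → Bool
triEdge 3 4 = true
triEdge 4 3 = true
triEdge i j = tri i j

tri-sym : ∀ i j → tri i j ≡ tri j i
tri-sym 0 0 = refl
tri-sym 0 1 = refl
tri-sym 0 2 = refl
tri-sym 0 (suc (suc (suc j))) = refl
tri-sym 1 0 = refl
tri-sym 1 1 = refl
tri-sym 1 2 = refl
tri-sym 1 (suc (suc (suc j))) = refl
tri-sym 2 0 = refl
tri-sym 2 1 = refl
tri-sym 2 2 = refl
tri-sym 2 (suc (suc (suc j))) = refl
tri-sym (suc (suc (suc i))) 0 = refl
tri-sym (suc (suc (suc i))) 1 = refl
tri-sym (suc (suc (suc i))) 2 = refl
tri-sym (suc (suc (suc i))) (suc (suc (suc j))) = refl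

tri-irr : ∀ i → tri i i ≡ false
tri-irr 0 = refl
tri-irr 1 = refl
tri-irr 2 = refl
tri-irr (suc (suc (suc i))) = refl

triEdge-sym : ∀ i j → triEdge i j ≡ triEdge j i
triEdge-sym 3 3 = refl
triEdge-sym 3 4 = refl
triEdge-sym 4 3 = refl
triEdge-sym 4 4 = refl
triEdge-sym 3 0 = refl
triEdge-sym 3 1 = refl
triEdge-sym 3 2 = refl
triEdge-sym 3 (suc (suc (suc (suc (suc j))))) = refl
triEdge-sym 4 0 = refl
triEdge-sym 4 1 = refl
triEdge-sym 4 2 = refl
triEdge-sym 4 (suc (suc (suc (suc (suc j))))) = refl
triEdge-sym 0 3 = refl
triEdge-sym 1 3 = refl
triEdge-sym 2 3 = refl
triEdge-sym (suc (suc (suc (suc (suc i))))) 3 = refl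
triEdge-sym 0 4 = refl
triEdge-sym 1 4 = refl
triEdge-sym 2 4 = refl
triEdge-sym (suc (suc (suc (suc (suc i))))) 4 = refl
triEdge-sym 0 0 = refl
triEdge-sym 0 1 = refl
triEdge-sym 0 2 = refl
triEdge-sym 0 (suc (suc (suc (suc (suc j))))) = refl
triEdge-sym 1 0 = refl
triEdge-sym 1 1 = refl
triEdge-sym 1 2 = refl
triEdge-sym 1 (suc (suc (suc (suc (suc j))))) = refl
triEdge-sym 2 0 = refl
triEdge-sym 2 1 = refl
triEdge-sym 2 2 = refl
triEdge-sym 2 (suc (suc (suc (suc (suc j))))) = refl
triEdge-sym (suc (suc (suc (suc (suc i))))) 0 = refl
triEdge-sym (suc (suc (suc (suc (suc i))))) 1 = refl
triEdge-sym (suc (suc (suc (suc (suc i))))) 2 = refl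
triEdge-sym (suc (suc (suc (suc (suc i))))) (suc (suc (suc (suc (suc j))))) = refl

triEdge-irr : ∀ i → triEdge i i ≡ false
triEdge-irr 0 = refl
triEdge-irr 1 = refl
triEdge-irr 2 = refl
triEdge-irr 3 = refl
triEdge-irr 4 = refl
triEdge-irr (suc (suc (suc (suc (suc i))))) = refl

-- K₃ ∪ (n-3)K₁ on Fin n: vertices 0,1,2 form a triangle, the rest isolated.
-- (Used only under the hypothesis n ≥ 3.)
K3∪K1s : (n : ℕ) → Graph n
K3∪K1s n = record
  { adj = λ i j → tri (toℕ i) (toℕ j)
  ; sym = λ i j → tri-sym (toℕ i) (toℕ j)
  ; irrefl = λ i → tri-irr (toℕ i) }

-- K₃ ∪ K₂ ∪ (n-5)K₁ on Fin n: triangle on 0,1,2, edge 3–4, rest isolated.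
-- (Used only under the hypothesis n ≥ 5.)
K3∪K2∪K1s : (n : ℕ) → Graph n
K3∪K2∪K1s n = record
  { adj = λ i j → triEdge (toℕ i) (toℕ j)
  ; sym = λ i j → triEdge-sym (toℕ i) (toℕ j)
  ; irrefl = λ i → triEdge-irr (toℕ i) }

-- A family of k pairwise edge-disjoint edge-pairs uses 2k distinct edges, and at most one edge of
-- each pair meets a given vertex v, so 2k ≤ |E| and deg v + k ≤ |E| are necessary.  Conversely they
-- suffice, by induction on k: call v tight when deg v + k = |E|.  Unless E is a triangle (k = 1) or
-- a triangle plus a disjoint edge (k = 2), some edge-pair meets every tight vertex, and deleting it
-- preserves both conditions for k - 1.  If the graph left behind is one of the two exceptions, its
-- triangle and the deleted pair rearrange into k pairs directly.  The theorem takes k = ⌊|E|/2⌋ when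
-- |E| ≥ 2Δ and k = |E| - Δ otherwise; an exceptional edge set is matched against a fixed template to
-- exhibit the forbidden isomorphism.

module Submission where

open import Defs renaming (sym to adj-sym)
open import Data.Nat using (ℕ; zero; suc; _+_; _*_; _∸_; _⊔_; _≤_; _<_; z≤n; s≤s; _/_; _≟_; _≤?_)
open import Data.Nat.Properties
open import Data.Nat.DivMod using (m/n*n≤m; m*n/n≡m; /-monoˡ-≤)
open import Data.Nat.Tactic.RingSolver using (solve-∀)
open import Data.Bool using (Bool; true)
open import Data.Bool.Properties using (⇔→≡) renaming (_≟_ to _≟ᵇ_)
open import Data.Fin using (Fin; toℕ; zero; suc; inject≤; fromℕ<; #_)
open import Data.Fin.Properties using (toℕ-injective; toℕ-inject≤; toℕ-fromℕ<; any?; all?) renaming (_≟_ to _≟ᶠ_)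
import Data.Fin.Properties as Fin
open import Data.Fin.Permutation using (Permutation′; _⟨$⟩ʳ_; _⟨$⟩ˡ_; inverseˡ; id; transpose; _∘ₚ_)
import Data.Fin.Permutation.Components as PC
open import Data.List using (List; []; _∷_; length; filter; map; foldr; lookup; allFin; _++_)
open import Data.List.Properties using (length-filter; filter-complete; length-map; length-tabulate; length-++)
open import Data.List.Relation.Unary.All using (All; []; _∷_)
import Data.List.Relation.Unary.All as All
open import Data.List.Relation.Unary.All.Properties using (all-filter)
import Data.List.Relation.Unary.All.Properties as Allₚ
open import Data.List.Relation.Unary.Any using (here; there)
import Data.List.Relation.Unary.Any as Any
open import Data.List.Relation.Unary.AllPairs using (AllPairs; allPairs?)
import Data.List.Relation.Unary.AllPairs as AllPairs
import Data.List.Relation.Unary.AllPairs.Properties as AllPairsₚ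
open import Data.List.Relation.Unary.Unique.Propositional using (Unique; []; _∷_)
import Data.List.Relation.Unary.Unique.Propositional.Properties as Unique
open import Data.List.Membership.Propositional using (_∈_; find; lose)
open import Data.List.Membership.Propositional.Properties using (∈-filter⁻; ∈-filter⁺; ∈-map⁻; ∈-lookup; ∈-++⁻; ∈-allFin; ∈-cartesianProduct⁺)
import Data.List.Membership.DecPropositional as DecMembership
open import Data.List.Relation.Binary.Subset.Propositional using (_⊆_)
open import Data.Product using (Σ; _×_; _,_; proj₁; proj₂; swap; uncurry)
open import Data.Product.Properties using (≡-dec)
open import Data.Sum using (_⊎_; inj₁; inj₂; [_,_]′)
open import Data.Empty using (⊥; ⊥-elim)
open import Function.Bundles using (mk⇔)
open import Level using (0ℓ)
open import Relation.Nullary using (¬_; Dec; yes; no)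
open import Relation.Nullary.Decidable using (_×-dec_; _⊎-dec_; _→-dec_; ¬?; from-yes)
open import Relation.Unary using (Pred; Decidable)
open import Relation.Binary using (DecidableEquality) renaming (Decidable to Decidable₂)
open import Relation.Binary.PropositionalEquality using (_≡_; _≢_; refl; sym; trans; cong; cong₂; subst; subst₂; ≢-sym; module ≡-Reasoning)

-- Counting in duplicate-free lists

module _ {A : Set} where

  remove-∈ : ∀ {x : A} {ys} → x ∈ ys →
             Σ (List A) λ zs → suc (length zs) ≡ length ys × (∀ {y} → y ∈ ys → y ≢ x → y ∈ zs)
  remove-∈ (here refl) = _ , refl , λ { (here y≡x) y≢x → ⊥-elim (y≢x y≡x) ; (there y∈) _ → y∈ }
  remove-∈ {ys = y ∷ ys} (there x∈) with zs , eq , keep ← remove-∈ x∈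
    = y ∷ zs , cong suc eq , λ { (here y≡) _ → here y≡ ; (there y∈) y≢x → there (keep y∈ y≢x) }

  unique-⊆⇒length≤ : ∀ {xs ys : List A} → Unique xs → xs ⊆ ys → length xs ≤ length ys
  unique-⊆⇒length≤ {[]} _ _ = z≤n
  unique-⊆⇒length≤ {x ∷ xs} (x∉xs ∷ u) xs⊆ys with zs , |zs|≡ , keep ← remove-∈ (xs⊆ys (here refl))
    = subst (suc (length xs) ≤_) |zs|≡
        (s≤s (unique-⊆⇒length≤ u λ y∈ → keep (xs⊆ys (there y∈)) λ y≡x → All.lookup x∉xs y∈ (sym y≡x)))

  length>0⇒∃∈ : ∀ {xs : List A} → 0 < length xs → Σ A λ x → x ∈ xs
  length>0⇒∃∈ {x ∷ _} _ = x , here refl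

  unique-map⁺ : ∀ {B : Set} (f : A → B) (g : B → A) {xs} → (∀ {x} → x ∈ xs → g (f x) ≡ x) → Unique xs → Unique (map f xs)
  unique-map⁺ f g {[]} _ [] = []
  unique-map⁺ f g {x ∷ xs} g∘f≡id (x∉xs ∷ u) =
    Allₚ.map⁺ (All.tabulate λ {y} y∈ fx≡fy →
      All.lookup x∉xs y∈ (trans (sym (g∘f≡id (here refl))) (trans (cong g fx≡fy) (g∘f≡id (there y∈)))))
    ∷ unique-map⁺ f g (λ x∈ → g∘f≡id (there x∈)) u

  unique-lookup-injective : ∀ {xs : List A} → Unique xs → ∀ {i j} → lookup xs i ≡ lookup xs j → i ≡ j
  unique-lookup-injective {_ ∷ _} _ {zero} {zero} _ = refl
  unique-lookup-injective {_ ∷ _} (x∉xs ∷ _) {zero} {suc j} x≡ = ⊥-elim (All.lookup x∉xs (∈-lookup j) x≡)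
  unique-lookup-injective {_ ∷ _} (x∉xs ∷ _) {suc i} {zero} ≡x = ⊥-elim (All.lookup x∉xs (∈-lookup i) (sym ≡x))
  unique-lookup-injective {_ ∷ _} (_ ∷ u) {suc i} {suc j} eq = cong suc (unique-lookup-injective u eq)

  module _ (_≟_ : DecidableEquality A) where
    open DecMembership _≟_ using (_∈?_)

    unique-⊆-length≥⇒⊇ : ∀ {xs ys : List A} → ys ⊆ xs → Unique ys → length xs ≤ length ys → xs ⊆ ys
    unique-⊆-length≥⇒⊇ {xs} {ys} ys⊆xs uys |xs|≤|ys| {x} x∈xs with x ∈? ys
    ... | yes x∈ys = x∈ys
    ... | no x∉ys = ⊥-elim (<-irrefl refl (≤-trans (unique-⊆⇒length≤ (x∉ys′ ∷ uys) x∷ys⊆xs) |xs|≤|ys|))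
      where
      x∉ys′ : All (x ≢_) ys
      x∉ys′ = All.tabulate λ y∈ x≡y → x∉ys (subst (_∈ ys) (sym x≡y) y∈)
      x∷ys⊆xs : x ∷ ys ⊆ xs
      x∷ys⊆xs (here refl) = x∈xs
      x∷ys⊆xs (there y∈) = ys⊆xs y∈

count : ∀ {A : Set} {P : Pred A 0ℓ} → Decidable P → List A → ℕ
count P? xs = length (filter P? xs)

module _ {A : Set} {P Q : Pred A 0ℓ} (P? : Decidable P) (Q? : Decidable Q) where

  count-mono-∈ : ∀ xs → (∀ {x} → x ∈ xs → P x → Q x) → count P? xs ≤ count Q? xs
  count-mono-∈ [] _ = z≤n
  count-mono-∈ (x ∷ xs) P⇒Q with P? x | Q? x | count-mono-∈ xs (λ x∈ → P⇒Q (there x∈))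
  ... | yes _ | yes _ | ih = s≤s ih
  ... | yes p | no ¬q | _ = ⊥-elim (¬q (P⇒Q (here refl) p))
  ... | no _ | yes _ | ih = m≤n⇒m≤1+n ih
  ... | no _ | no _ | ih = ih

  count-mono : (∀ {x} → P x → Q x) → ∀ xs → count P? xs ≤ count Q? xs
  count-mono P⇒Q xs = count-mono-∈ xs (λ _ → P⇒Q)

  count-mono-< : (∀ {x} → P x → Q x) → ∀ {xs y} → y ∈ xs → Q y → ¬ P y → count P? xs < count Q? xs
  count-mono-< P⇒Q {x ∷ xs} (here refl) qx ¬px with P? x | Q? x
  ... | yes px | _ = ⊥-elim (¬px px)
  ... | no _ | no ¬qx = ⊥-elim (¬qx qx)
  ... | no _ | yes _ = s≤s (count-mono P⇒Q xs)
  count-mono-< P⇒Q {x ∷ xs} (there y∈) qy ¬py with P? x | Q? x | count-mono-< P⇒Q y∈ qy ¬py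
  ... | yes px | no ¬qx | _ = ⊥-elim (¬qx (P⇒Q px))
  ... | yes _ | yes _ | ih = s≤s ih
  ... | no _ | yes _ | ih = m≤n⇒m≤1+n ih
  ... | no _ | no _ | ih = ih

  count-∪+count-∩ : ∀ xs → count (λ x → P? x ⊎-dec Q? x) xs + count (λ x → P? x ×-dec Q? x) xs
                           ≡ count P? xs + count Q? xs
  count-∪+count-∩ [] = refl
  count-∪+count-∩ (x ∷ xs) with P? x | Q? x | count-∪+count-∩ xs
  ... | yes _ | yes _ | ih = cong suc (trans (+-suc _ _) (trans (cong suc ih) (sym (+-suc _ _))))
  ... | yes _ | no _ | ih = cong suc ih
  ... | no _ | yes _ | ih = trans (cong suc ih) (sym (+-suc _ _))
  ... | no _ | no _ | ih = ih

  count-filter : ∀ xs → count P? (filter Q? xs) ≡ count (λ x → P? x ×-dec Q? x) xs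
  count-filter [] = refl
  count-filter (x ∷ xs) with Q? x
  ... | no _ with P? x
  ...   | yes _ = count-filter xs
  ...   | no _ = count-filter xs
  count-filter (x ∷ xs) | yes _ with P? x
  ...   | yes _ = cong suc (count-filter xs)
  ...   | no _ = count-filter xs

module _ {A : Set} {P : Pred A 0ℓ} (P? : Decidable P) where

  count+count-∁ : ∀ xs → count P? xs + count (λ x → ¬? (P? x)) xs ≡ length xs
  count+count-∁ [] = refl
  count+count-∁ (x ∷ xs) with P? x
  ... | yes _ = cong suc (count+count-∁ xs)
  ... | no _ = trans (+-suc _ _) (cong suc (count+count-∁ xs))

  count>0⇒∃ : ∀ xs → 0 < count P? xs → Σ A λ x → x ∈ xs × P x
  count>0⇒∃ xs 0<c with x ∷ _ ← filter P? xs in eq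
    = x , proj₁ (∈-filter⁻ P? {xs = xs} x∈) , proj₂ (∈-filter⁻ P? {xs = xs} x∈)
    where
    x∈ : x ∈ filter P? xs
    x∈ = subst (x ∈_) (sym eq) (here refl)

  count<length⇒∃∁ : ∀ xs → count P? xs < length xs → Σ A λ x → x ∈ xs × ¬ P x
  count<length⇒∃∁ (x ∷ xs) c< with P? x
  ... | no ¬px = x , here refl , ¬px
  ... | yes _ with y , y∈ , ¬py ← count<length⇒∃∁ xs (≤-pred c<) = y , there y∈ , ¬py

  count≡length⇒All : ∀ {xs} → count P? xs ≡ length xs → All P xs
  count≡length⇒All {xs} eq = subst (All P) (filter-complete P? eq) (all-filter P? xs)

  unique-⊆-count≥ : ∀ {xs ys} → Unique ys → (∀ {y} → y ∈ ys → y ∈ xs × P y) → length ys ≤ count P? xs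
  unique-⊆-count≥ uys ys⊆ = unique-⊆⇒length≤ uys λ y∈ → ∈-filter⁺ P? (proj₁ (ys⊆ y∈)) (proj₂ (ys⊆ y∈))

  count≤1 : ∀ {xs} {c : A} → Unique xs → (∀ {x} → x ∈ xs → P x → x ≡ c) → count P? xs ≤ 1
  count≤1 {xs} u only-c = unique-⊆⇒length≤ {ys = _ ∷ []} (Unique.filter⁺ P? u)
    λ x∈ → here (only-c (proj₁ (∈-filter⁻ P? {xs = xs} x∈)) (proj₂ (∈-filter⁻ P? {xs = xs} x∈)))

  count≤1⇒≡ : DecidableEquality A → ∀ {xs} {a b : A} → count P? xs ≤ 1 → a ∈ xs → b ∈ xs → P a → P b → a ≡ b
  count≤1⇒≡ _≟_ {a = a} {b} c≤1 a∈ b∈ pa pb with a ≟ b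
  ... | yes a≡b = a≡b
  ... | no a≢b = ⊥-elim (<-irrefl refl (≤-trans (unique-⊆-count≥ ((a≢b ∷ []) ∷ [] ∷ [])
                   λ { (here refl) → a∈ , pa ; (there (here refl)) → b∈ , pb }) c≤1))

-- Simple graphs as edge lists

Edge : ℕ → Set
Edge n = Fin n × Fin n

module _ {n : ℕ} where

  _≟ₑ_ : DecidableEquality (Edge n)
  _≟ₑ_ = ≡-dec _≟ᶠ_ _≟ᶠ_

  Canonical : Edge n → Set
  Canonical (x , y) = toℕ x < toℕ y

  Incident : Fin n → Edge n → Set
  Incident v (x , y) = (v ≡ x) ⊎ (v ≡ y)

  incident? : ∀ v → Decidable (Incident v)
  incident? v (x , y) = (v ≟ᶠ x) ⊎-dec (v ≟ᶠ y)

  Joins : Edge n → Fin n → Fin n → Set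
  Joins e x y = (e ≡ (x , y)) ⊎ (e ≡ (y , x))

  Adj : List (Edge n) → Fin n → Fin n → Set
  Adj E x y = ((x , y) ∈ E) ⊎ ((y , x) ∈ E)

  Simple : List (Edge n) → Set
  Simple E = All Canonical E × Unique E

  deg : List (Edge n) → Fin n → ℕ
  deg E v = count (incident? v) E

  both either : List (Edge n) → Fin n → Fin n → ℕ
  both E u x = count (λ e → incident? u e ×-dec incident? x e) E
  either E u x = count (λ e → incident? u e ⊎-dec incident? x e) E

  edgeBetween : Fin n → Fin n → Edge n
  edgeBetween v j with toℕ v <? toℕ j
  ... | yes _ = v , j
  ... | no _ = j , v

  edgeBetween-joins : ∀ v j → Joins (edgeBetween v j) v j
  edgeBetween-joins v j with toℕ v <? toℕ j
  ... | yes _ = inj₁ refl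
  ... | no _ = inj₂ refl

  incident₁ : ∀ {e : Edge n} → Incident (proj₁ e) e
  incident₁ = inj₁ refl

  incident₂ : ∀ {e : Edge n} → Incident (proj₂ e) e
  incident₂ = inj₂ refl

  incident⇒≢ : ∀ {v : Fin n} {e f} → Incident v e → ¬ Incident v f → e ≢ f
  incident⇒≢ ve ¬vf refl = ¬vf ve

  ¬incident⇒≢ : ∀ {u z : Fin n} {e} → ¬ Incident u e → Incident z e → u ≢ z
  ¬incident⇒≢ ¬ue ze refl = ¬ue ze

  canonical⇒≢ : ∀ {x y : Fin n} → Canonical (x , y) → x ≢ y
  canonical⇒≢ x<y refl = <-irrefl refl x<y

  joins-incident₁ : ∀ {e x y} → Joins e x y → Incident x e
  joins-incident₁ (inj₁ refl) = inj₁ refl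
  joins-incident₁ (inj₂ refl) = inj₂ refl

  joins-incident₂ : ∀ {e x y} → Joins e x y → Incident y e
  joins-incident₂ (inj₁ refl) = inj₂ refl
  joins-incident₂ (inj₂ refl) = inj₁ refl

  joins-¬incident : ∀ {e x y z} → Joins e x y → z ≢ x → z ≢ y → ¬ Incident z e
  joins-¬incident (inj₁ refl) z≢x _ (inj₁ z≡x) = z≢x z≡x
  joins-¬incident (inj₁ refl) _ z≢y (inj₂ z≡y) = z≢y z≡y
  joins-¬incident (inj₂ refl) _ z≢y (inj₁ z≡y) = z≢y z≡y
  joins-¬incident (inj₂ refl) z≢x _ (inj₂ z≡x) = z≢x z≡x

  edgeBetween-incident₁ : ∀ v j → Incident v (edgeBetween v j)
  edgeBetween-incident₁ v j = joins-incident₁ (edgeBetween-joins v j)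

  joins-unique : ∀ {e : Edge n} {x y p q} → Joins e x y → Joins e p q → ((x ≡ p) × (y ≡ q)) ⊎ ((x ≡ q) × (y ≡ p))
  joins-unique (inj₁ refl) (inj₁ refl) = inj₁ (refl , refl)
  joins-unique (inj₁ refl) (inj₂ refl) = inj₂ (refl , refl)
  joins-unique (inj₂ refl) (inj₁ refl) = inj₂ (refl , refl)
  joins-unique (inj₂ refl) (inj₂ refl) = inj₁ (refl , refl)

  incident⇒joins : ∀ {u} {e : Edge n} → Incident u e → Σ (Fin n) λ z → Joins e u z
  incident⇒joins (inj₁ refl) = _ , inj₁ refl
  incident⇒joins (inj₂ refl) = _ , inj₂ refl

  Adj⇒Joins : ∀ {E x y} → Adj E x y → Σ (Edge n) λ e → e ∈ E × Joins e x y
  Adj⇒Joins (inj₁ e∈) = _ , e∈ , inj₁ refl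
  Adj⇒Joins (inj₂ e∈) = _ , e∈ , inj₂ refl

  Adj-sym : ∀ {E x y} → Adj E x y → Adj E y x
  Adj-sym (inj₁ e∈) = inj₂ e∈
  Adj-sym (inj₂ e∈) = inj₁ e∈

  ¬incident⇒independent : ∀ {e f : Edge n} → ¬ Incident (proj₁ f) e → ¬ Incident (proj₂ f) e → Independent e f
  ¬incident⇒independent ¬f₁e ¬f₂e =
    (λ a≡c → ¬f₁e (inj₁ (sym a≡c))) , (λ a≡d → ¬f₂e (inj₁ (sym a≡d))) ,
    (λ b≡c → ¬f₁e (inj₂ (sym b≡c))) , (λ b≡d → ¬f₂e (inj₂ (sym b≡d)))

  ¬incident-joins⇒independent : ∀ {e f x y} → ¬ Incident x e → ¬ Incident y e → Joins f x y → Independent e f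
  ¬incident-joins⇒independent ¬xe ¬ye (inj₁ refl) = ¬incident⇒independent ¬xe ¬ye
  ¬incident-joins⇒independent ¬xe ¬ye (inj₂ refl) = ¬incident⇒independent ¬ye ¬xe

  independent⇒¬shared : ∀ {e f : Edge n} {z} → Independent e f → Incident z e → ¬ Incident z f
  independent⇒¬shared (a≢c , _ , _ , _) (inj₁ refl) (inj₁ refl) = a≢c refl
  independent⇒¬shared (_ , a≢d , _ , _) (inj₁ refl) (inj₂ refl) = a≢d refl
  independent⇒¬shared (_ , _ , b≢c , _) (inj₂ refl) (inj₁ refl) = b≢c refl
  independent⇒¬shared (_ , _ , _ , b≢d) (inj₂ refl) (inj₂ refl) = b≢d refl

  independent-sym : ∀ {e f : Edge n} → Independent e f → Independent f e
  independent-sym (a≢c , a≢d , b≢c , b≢d) = ≢-sym a≢c , ≢-sym b≢c , ≢-sym a≢d , ≢-sym b≢d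

  independent⇒≢ : ∀ {e f : Edge n} → Independent e f → e ≢ f
  independent⇒≢ (a≢c , _) refl = a≢c refl

  canonical-unique : ∀ {e f : Edge n} {x y} → Canonical e → Canonical f → x ≢ y →
                     Incident x e → Incident y e → Incident x f → Incident y f → e ≡ f
  canonical-unique {a , b} {c , d} {x} {y} ce cf x≢y = go
    where
    go : Incident x (a , b) → Incident y (a , b) → Incident x (c , d) → Incident y (c , d) → (a , b) ≡ (c , d)
    go (inj₁ refl) (inj₁ refl) _ _ = ⊥-elim (x≢y refl)
    go (inj₂ refl) (inj₂ refl) _ _ = ⊥-elim (x≢y refl)
    go _ _ (inj₁ refl) (inj₁ refl) = ⊥-elim (x≢y refl)
    go _ _ (inj₂ refl) (inj₂ refl) = ⊥-elim (x≢y refl)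
    go (inj₁ refl) (inj₂ refl) (inj₁ refl) (inj₂ refl) = refl
    go (inj₂ refl) (inj₁ refl) (inj₂ refl) (inj₁ refl) = refl
    go (inj₁ refl) (inj₂ refl) (inj₂ refl) (inj₁ refl) = ⊥-elim (<-asym ce cf)
    go (inj₂ refl) (inj₁ refl) (inj₁ refl) (inj₂ refl) = ⊥-elim (<-asym ce cf)

  either+both : ∀ E u x → either E u x + both E u x ≡ deg E u + deg E x
  either+both E u x = count-∪+count-∩ (incident? u) (incident? x) E

  both-sym : ∀ E u x → both E u x ≡ both E x u
  both-sym E u x = ≤-antisym (count-mono _ _ swap E) (count-mono _ _ swap E)

  deg≤both+both : ∀ E x u w → (∀ {g} → g ∈ E → Incident x g → Incident u g ⊎ Incident w g) →
                  deg E x ≤ both E x u + both E x w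
  deg≤both+both E x u w to-u-or-w =
    ≤-trans (count-mono-∈ (incident? x) (λ g → ux? g ⊎-dec wx? g) E split)
            (≤-trans (m≤m+n _ _) (≤-reflexive (count-∪+count-∩ ux? wx? E)))
    where
    ux? : Decidable λ g → Incident x g × Incident u g
    ux? g = incident? x g ×-dec incident? u g
    wx? : Decidable λ g → Incident x g × Incident w g
    wx? g = incident? x g ×-dec incident? w g
    split : ∀ {g} → g ∈ E → Incident x g → (Incident x g × Incident u g) ⊎ (Incident x g × Incident w g)
    split g∈ xg with to-u-or-w g∈ xg
    ... | inj₁ ug = inj₁ (xg , ug)
    ... | inj₂ wg = inj₂ (xg , wg)

  incident⇒both≥1 : ∀ {E u x e} → e ∈ E → Incident u e → Incident x e → 1 ≤ both E u x
  incident⇒both≥1 e∈ ue xe = unique-⊆-count≥ _ ([] ∷ []) λ { (here refl) → e∈ , ue , xe }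

  Adj⇒both≥1 : ∀ {E u x} → Adj E u x → 1 ≤ both E u x
  Adj⇒both≥1 (inj₁ e∈) = incident⇒both≥1 e∈ (inj₁ refl) (inj₂ refl)
  Adj⇒both≥1 (inj₂ e∈) = incident⇒both≥1 e∈ (inj₂ refl) (inj₁ refl)

  avoiding-edge-or-deg≤ : ∀ E u p q → (Σ (Edge n) λ h → h ∈ E × Incident u h × ¬ Incident p h × ¬ Incident q h) ⊎
                          deg E u ≤ both E u p + both E u q
  avoiding-edge-or-deg≤ E u p q with Any.any? (λ h → incident? u h ×-dec ¬? (incident? p h ⊎-dec incident? q h)) E
  ... | yes found with h , h∈ , uh , ¬pq ← find found = inj₁ (h , h∈ , uh , (λ ph → ¬pq (inj₁ ph)) , (λ qh → ¬pq (inj₂ qh)))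
  ... | no none = inj₂ (deg≤both+both E u p q to-p-or-q)
    where
    to-p-or-q : ∀ {h} → h ∈ E → Incident u h → Incident p h ⊎ Incident q h
    to-p-or-q {h} h∈ uh with incident? p h ⊎-dec incident? q h
    ... | yes pq = pq
    ... | no ¬pq = ⊥-elim (none (lose h∈ (uh , ¬pq)))

  module _ {E : List (Edge n)} (simple : Simple E) where

    canonical : ∀ {e} → e ∈ E → Canonical e
    canonical = All.lookup (proj₁ simple)

    both≤1 : ∀ {u x} → u ≢ x → both E u x ≤ 1
    both≤1 {u} {x} u≢x with 0 <? both E u x
    ... | no ¬0< = ≤-trans (≮⇒≥ ¬0<) z≤n
    ... | yes 0< with e , e∈ , ue , xe ← count>0⇒∃ (λ e → incident? u e ×-dec incident? x e) E 0<
      = count≤1 _ (proj₂ simple) λ f∈ (uf , xf) → canonical-unique (canonical f∈) (canonical e∈) u≢x uf xf ue xe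

    both≥1⇒Adj : ∀ {u x} → 1 ≤ both E u x → u ≢ x → Adj E u x
    both≥1⇒Adj {u} {x} 1≤ u≢x with count>0⇒∃ (λ e → incident? u e ×-dec incident? x e) E 1≤
    ... | _ , e∈ , inj₁ refl , inj₂ refl = inj₁ e∈
    ... | _ , e∈ , inj₂ refl , inj₁ refl = inj₂ e∈
    ... | _ , _ , inj₁ refl , inj₁ refl = ⊥-elim (u≢x refl)
    ... | _ , _ , inj₂ refl , inj₂ refl = ⊥-elim (u≢x refl)

    deg≥2 : ∀ {z e f} → e ∈ E → f ∈ E → e ≢ f → Incident z e → Incident z f → 2 ≤ deg E z
    deg≥2 e∈ f∈ e≢f ze zf = unique-⊆-count≥ _ ((e≢f ∷ []) ∷ [] ∷ [])
      λ { (here refl) → e∈ , ze ; (there (here refl)) → f∈ , zf }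

    deg≥2-via : ∀ {s z e} → Adj E s z → e ∈ E → Incident z e → ¬ Incident s e → 2 ≤ deg E z
    deg≥2-via sz e∈ ze ¬se with f , f∈ , f-sz ← Adj⇒Joins sz
      = deg≥2 e∈ f∈ (≢-sym (incident⇒≢ (joins-incident₁ f-sz) ¬se)) ze (joins-incident₂ f-sz)

    Joins⇒≢ : ∀ {e x y} → e ∈ E → Joins e x y → x ≢ y
    Joins⇒≢ e∈ (inj₁ refl) = canonical⇒≢ (canonical e∈)
    Joins⇒≢ e∈ (inj₂ refl) = ≢-sym (canonical⇒≢ (canonical e∈))

-- Packings of edge-pairs

module _ {n : ℕ} where

  EdgePairIn : List (Edge n) → Edge n × Edge n → Set
  EdgePairIn E (e , f) = e ∈ E × f ∈ E × Independent e f

  Packing : List (Edge n) → ℕ → Set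
  Packing E k = Σ (List (Edge n × Edge n)) λ ps → All (EdgePairIn E) ps × Unique (edgesOf ps) × length ps ≡ k

  Triangle : List (Edge n) → Fin n → Fin n → Fin n → Set
  Triangle E a b c = Unique (a ∷ b ∷ c ∷ []) × Adj E a b × Adj E b c × Adj E a c

  IsK₃ : List (Edge n) → Set
  IsK₃ E = Σ (Fin n) λ a → Σ (Fin n) λ b → Σ (Fin n) λ c → Triangle E a b c × length E ≡ 3

  IsK₃∪K₂ : List (Edge n) → Set
  IsK₃∪K₂ E = Σ (Fin n) λ a → Σ (Fin n) λ b → Σ (Fin n) λ c → Σ (Fin n) λ x → Σ (Fin n) λ y →
    Unique (a ∷ b ∷ c ∷ x ∷ y ∷ []) × Adj E a b × Adj E b c × Adj E a c × Adj E x y × length E ≡ 4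

  Exceptional : ℕ → List (Edge n) → Set
  Exceptional k E = (k ≡ 1 × IsK₃ E) ⊎ (k ≡ 2 × IsK₃∪K₂ E)

  -- No slack in the necessary condition deg v + k ≤ |E| for a packing of k pairs.
  Tight : List (Edge n) → ℕ → Fin n → Set
  Tight E k v = deg E v + k ≡ length E

  CoveringPair : List (Edge n) → ℕ → Edge n → Edge n → Set
  CoveringPair E k e f = EdgePairIn E (e , f) × (∀ v → Tight E k v → Incident v e ⊎ Incident v f)

  triangle-rotate : ∀ {E a b c} → Triangle E a b c → Triangle E b c a
  triangle-rotate (((a≢b ∷ a≢c ∷ []) ∷ (b≢c ∷ []) ∷ [] ∷ []) , ab , bc , ac) =
    ((b≢c ∷ ≢-sym a≢b ∷ []) ∷ (≢-sym a≢c ∷ []) ∷ [] ∷ []) , bc , Adj-sym ac , Adj-sym ab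

  triangle-swap₁₂ : ∀ {E a b c} → Triangle E a b c → Triangle E b a c
  triangle-swap₁₂ (((a≢b ∷ a≢c ∷ []) ∷ (b≢c ∷ []) ∷ [] ∷ []) , ab , bc , ac) =
    ((≢-sym a≢b ∷ b≢c ∷ []) ∷ (a≢c ∷ []) ∷ [] ∷ []) , Adj-sym ab , ac , bc

  triangle-swap₂₃ : ∀ {E a b c} → Triangle E a b c → Triangle E a c b
  triangle-swap₂₃ (((a≢b ∷ a≢c ∷ []) ∷ (b≢c ∷ []) ∷ [] ∷ []) , ab , bc , ac) =
    ((a≢c ∷ a≢b ∷ []) ∷ (≢-sym b≢c ∷ []) ∷ [] ∷ []) , ac , Adj-sym bc , ab

  avoids? : (e f : Edge n) → Decidable λ g → (g ≢ e) × (g ≢ f)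
  avoids? e f g = ¬? (g ≟ₑ e) ×-dec ¬? (g ≟ₑ f)

  _∖[_,_] : List (Edge n) → Edge n → Edge n → List (Edge n)
  E ∖[ e , f ] = filter (avoids? e f) E

  ∈-∖⁻ : ∀ {E e f g} → g ∈ E ∖[ e , f ] → g ∈ E × g ≢ e × g ≢ f
  ∈-∖⁻ {E} g∈ = ∈-filter⁻ (avoids? _ _) {xs = E} g∈

  ∖-simple : ∀ {E e f} → Simple E → Simple (E ∖[ e , f ])
  ∖-simple (canon , unique) = Allₚ.filter⁺ _ canon , Unique.filter⁺ _ unique

  ∖-length : ∀ {E e f} → Simple E → length E ≤ length (E ∖[ e , f ]) + 2
  ∖-length {E} {e} {f} (_ , unique) =
    subst (_≤ length (E ∖[ e , f ]) + 2) (count+count-∁ (avoids? e f) E) (+-monoʳ-≤ _ at-most-two)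
    where
    removed : ∀ {g} → ¬ (g ≢ e × g ≢ f) → g ∈ e ∷ f ∷ []
    removed {g} ¬avoid with g ≟ₑ e | g ≟ₑ f
    ... | yes g≡e | _ = here g≡e
    ... | no _ | yes g≡f = there (here g≡f)
    ... | no g≢e | no g≢f = ⊥-elim (¬avoid (g≢e , g≢f))
    at-most-two : count (λ g → ¬? (avoids? e f g)) E ≤ 2
    at-most-two = unique-⊆⇒length≤ (Unique.filter⁺ _ unique)
      λ g∈ → removed (proj₂ (∈-filter⁻ (λ g → ¬? (avoids? e f g)) {xs = E} g∈))

  ∖-deg≤ : ∀ {E e f} v → deg (E ∖[ e , f ]) v ≤ deg E v
  ∖-deg≤ {E} {e} {f} v = subst (_≤ deg E v) (sym (count-filter (incident? v) (avoids? e f) E))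
    (count-mono _ (incident? v) proj₁ E)

  ∖-deg< : ∀ {E e f g} v → g ∈ E → Incident v g → ¬ (g ≢ e × g ≢ f) → deg (E ∖[ e , f ]) v < deg E v
  ∖-deg< {E} {e} {f} v g∈ vg removed = subst (_< deg E v) (sym (count-filter (incident? v) (avoids? e f) E))
    (count-mono-< _ (incident? v) proj₁ g∈ vg (λ (_ , avoids) → removed avoids))

  module _ {E : List (Edge n)} (simple : Simple E) {e f : Edge n} (e∈ : e ∈ E) (f∈ : f ∈ E) (e⊥f : Independent e f) where

    private
      E′ : List (Edge n)
      E′ = E ∖[ e , f ]

      ∈E : ∀ {t} → t ∈ E′ → t ∈ E
      ∈E t∈ = proj₁ (∈-∖⁻ {E = E} t∈)

      ≢e : ∀ {t} → t ∈ E′ → t ≢ e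
      ≢e t∈ = proj₁ (proj₂ (∈-∖⁻ {E = E} t∈))

      ≢f : ∀ {t} → t ∈ E′ → t ≢ f
      ≢f t∈ = proj₂ (proj₂ (∈-∖⁻ {E = E} t∈))

    -- Otherwise g would be the edge of E′ joining x and y.
    deleted-¬joins : ∀ {g x y} → g ∈ E → (∀ {t} → t ∈ E′ → t ≢ g) → Adj E′ x y → x ≢ y → Incident x g → ¬ Incident y g
    deleted-¬joins g∈ ≢g xy x≢y xg yg with t , t∈ , t-xy ← Adj⇒Joins xy =
      ≢g t∈ (sym (canonical-unique (canonical simple g∈) (canonical simple (∈E t∈)) x≢y xg yg
                    (joins-incident₁ t-xy) (joins-incident₂ t-xy)))

    private
      e-meets-once : ∀ {x y} → Adj E′ x y → x ≢ y → Incident x e → ¬ Incident y e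
      e-meets-once = deleted-¬joins e∈ ≢e
      f-meets-once : ∀ {x y} → Adj E′ x y → x ≢ y → Incident x f → ¬ Incident y f
      f-meets-once = deleted-¬joins f∈ ≢f

    Labelling : Fin n → Fin n → Fin n → Set
    Labelling a b c = Σ (Fin n) λ p → Σ (Fin n) λ q → Σ (Fin n) λ r →
      p ∈ a ∷ b ∷ c ∷ [] × q ∈ a ∷ b ∷ c ∷ [] × Triangle E′ p q r ×
      ¬ Incident q e × ¬ Incident r e × ¬ Incident p f × ¬ Incident r f

    private
      pattern 1st = here refl
      pattern 2nd = there (here refl)
      pattern 3rd = there (there (here refl))

      rotate : ∀ {a b c} → Labelling b c a → Labelling a b c
      rotate (p , q , r , p∈ , q∈ , rest) = p , q , r , rot p∈ , rot q∈ , rest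
        where
        rot : ∀ {a b c z : Fin n} → z ∈ b ∷ c ∷ a ∷ [] → z ∈ a ∷ b ∷ c ∷ []
        rot (here z≡b) = there (here z≡b)
        rot (there (here z≡c)) = there (there (here z≡c))
        rot (there (there (here z≡a))) = here z≡a

      labelling-via : ∀ {a b c} → Triangle E′ a b c → Incident a e → Labelling a b c
      labelling-via {a} {b} {c} t@(((a≢b ∷ a≢c ∷ []) ∷ (b≢c ∷ []) ∷ [] ∷ []) , ab , bc , ac) ae with incident? b f
      ... | yes bf = a , b , c , 1st , 2nd , t , e-meets-once ab a≢b ae , e-meets-once ac a≢c ae ,
                     independent⇒¬shared e⊥f ae , f-meets-once bc b≢c bf
      ... | no ¬bf = a , c , b , 1st , 3rd , triangle-swap₂₃ t , e-meets-once ac a≢c ae , e-meets-once ab a≢b ae ,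
                     independent⇒¬shared e⊥f ae , ¬bf

    labelling : ∀ {a b c} → Triangle E′ a b c → Labelling a b c
    labelling {a} {b} {c} t@(((a≢b ∷ a≢c ∷ []) ∷ (b≢c ∷ []) ∷ [] ∷ []) , ab , bc , ac)
      with incident? a e | incident? b e | incident? c e
    ... | yes ae | _ | _ = labelling-via t ae
    ... | no _ | yes be | _ = rotate (labelling-via (triangle-rotate t) be)
    ... | no _ | no _ | yes ce = rotate (rotate (labelling-via (triangle-rotate (triangle-rotate t)) ce))
    ... | no ¬ae | no ¬be | no ¬ce with incident? a f | incident? b f | incident? c f
    ...   | yes af | _ | _ = b , a , c , 2nd , 1st , triangle-swap₁₂ t , ¬ae , ¬ce ,
                             f-meets-once ab a≢b af , f-meets-once ac a≢c af
    ...   | no ¬af | yes bf | _ = a , b , c , 1st , 2nd , t , ¬be , ¬ce , ¬af , f-meets-once bc b≢c bf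
    ...   | no ¬af | no ¬bf | yes _ = a , c , b , 1st , 3rd , triangle-swap₂₃ t , ¬ce , ¬be , ¬af , ¬bf
    ...   | no ¬af | no _ | no ¬cf = a , b , c , 1st , 2nd , t , ¬be , ¬ce , ¬af , ¬cf

    K₃-residual⇒packing : IsK₃ E′ → Packing E 2
    K₃-residual⇒packing (a , b , c , t , _) with labelling t
    ... | p , q , r , _ , _ , (((p≢q ∷ _) ∷ (q≢r ∷ []) ∷ [] ∷ []) , _ , qr , pr) , ¬qe , ¬re , ¬pf , ¬rf
      with g , g∈ , g-qr ← Adj⇒Joins qr | h , h∈ , h-pr ← Adj⇒Joins pr =
      (e , g) ∷ (f , h) ∷ [] ,
      (e∈ , ∈E g∈ , ¬incident-joins⇒independent ¬qe ¬re g-qr) ∷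
      (f∈ , ∈E h∈ , ¬incident-joins⇒independent ¬pf ¬rf h-pr) ∷ [] ,
      (≢-sym (≢e g∈) ∷ independent⇒≢ e⊥f ∷ ≢-sym (≢e h∈) ∷ []) ∷ (≢f g∈ ∷ g≢h ∷ []) ∷ (≢-sym (≢f h∈) ∷ []) ∷ [] ∷ [] ,
      refl
      where
      g≢h : g ≢ h
      g≢h = incident⇒≢ (joins-incident₁ g-qr) (joins-¬incident h-pr (≢-sym p≢q) q≢r)

    K₃∪K₂-residual⇒packing : IsK₃∪K₂ E′ → Packing E 3
    K₃∪K₂-residual⇒packing
      (a , b , c , x , y , ((a≢b ∷ a≢c ∷ a≢x ∷ a≢y ∷ []) ∷ (b≢c ∷ b≢x ∷ b≢y ∷ []) ∷ (c≢x ∷ c≢y ∷ []) ∷ _) , ab , bc , ac , xy , _)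
      with labelling (((a≢b ∷ a≢c ∷ []) ∷ (b≢c ∷ []) ∷ [] ∷ []) , ab , bc , ac)
    ... | p , q , r , p∈ , q∈ , (((p≢q ∷ p≢r ∷ []) ∷ (q≢r ∷ []) ∷ [] ∷ []) , pq , qr , pr) , ¬qe , ¬re , ¬pf , ¬rf
      with g , g∈ , g-qr ← Adj⇒Joins qr | h , h∈ , h-pr ← Adj⇒Joins pr
         | i , i∈ , i-pq ← Adj⇒Joins pq | j , j∈ , j-xy ← Adj⇒Joins xy =
      (e , g) ∷ (f , h) ∷ (j , i) ∷ [] ,
      (e∈ , ∈E g∈ , ¬incident-joins⇒independent ¬qe ¬re g-qr) ∷ (f∈ , ∈E h∈ , ¬incident-joins⇒independent ¬pf ¬rf h-pr) ∷
      (∈E j∈ , ∈E i∈ , ¬incident-joins⇒independent (¬xy p∈) (¬xy q∈) i-pq) ∷ [] ,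
      (≢-sym (≢e g∈) ∷ independent⇒≢ e⊥f ∷ ≢-sym (≢e h∈) ∷ ≢-sym (≢e j∈) ∷ ≢-sym (≢e i∈) ∷ []) ∷
      (≢f g∈ ∷ g≢h ∷ g≢j ∷ g≢i ∷ []) ∷
      (≢-sym (≢f h∈) ∷ ≢-sym (≢f j∈) ∷ ≢-sym (≢f i∈) ∷ []) ∷
      (h≢j ∷ h≢i ∷ []) ∷
      (≢-sym i≢j ∷ []) ∷ [] ∷ [] ,
      refl
      where
      ¬xy : ∀ {z} → z ∈ a ∷ b ∷ c ∷ [] → ¬ Incident z j
      ¬xy 1st = joins-¬incident j-xy a≢x a≢y
      ¬xy 2nd = joins-¬incident j-xy b≢x b≢y
      ¬xy 3rd = joins-¬incident j-xy c≢x c≢y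
      g≢h : g ≢ h
      g≢h = incident⇒≢ (joins-incident₁ g-qr) (joins-¬incident h-pr (≢-sym p≢q) q≢r)
      g≢i : g ≢ i
      g≢i = incident⇒≢ (joins-incident₂ g-qr) (joins-¬incident i-pq (≢-sym p≢r) (≢-sym q≢r))
      h≢i : h ≢ i
      h≢i = incident⇒≢ (joins-incident₂ h-pr) (joins-¬incident i-pq (≢-sym p≢r) (≢-sym q≢r))
      g≢j : g ≢ j
      g≢j = incident⇒≢ (joins-incident₁ g-qr) (¬xy q∈)
      h≢j : h ≢ j
      h≢j = incident⇒≢ (joins-incident₁ h-pr) (¬xy p∈)
      i≢j : i ≢ j
      i≢j = incident⇒≢ (joins-incident₁ i-pq) (¬xy p∈)

  edgesOf-⊆ : ∀ {E ps} → All (EdgePairIn E) ps → All (_∈ E) (edgesOf ps)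
  edgesOf-⊆ [] = []
  edgesOf-⊆ ((e∈ , f∈ , _) ∷ ps∈) = e∈ ∷ f∈ ∷ edgesOf-⊆ ps∈

-- Covering the tight vertices by one edge-pair

private
  1≤+⇒ : ∀ a b → 1 ≤ a + b → 1 ≤ a ⊎ 1 ≤ b
  1≤+⇒ zero b 1≤b = inj₂ 1≤b
  1≤+⇒ (suc a) b _ = inj₁ (s≤s z≤n)

  2≤+⇒ : ∀ {a b} → 2 ≤ a + b → a ≤ 1 → b ≤ 1 → 1 ≤ a × 1 ≤ b
  2≤+⇒ {1} {1} _ _ _ = s≤s z≤n , s≤s z≤n
  2≤+⇒ {0} 2≤b _ (s≤s b≤0) with () ← ≤-trans (≤-pred 2≤b) b≤0
  2≤+⇒ {1} {0} (s≤s ()) _ _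
  2≤+⇒ {suc (suc _)} _ (s≤s ()) _
  2≤+⇒ {1} {suc (suc _)} _ _ (s≤s ())

  2*n≡n+n : ∀ a → 2 * a ≡ a + a
  2*n≡n+n a = cong (a +_) (+-identityʳ a)

module _ {n : ℕ} {E : List (Edge n)} (simple : Simple E) (k : ℕ) (1≤k : 1 ≤ k) (2k≤m : 2 * k ≤ length E)
         (deg≤ : ∀ v → deg E v + k ≤ length E) where

  private
    m : ℕ
    m = length E

    Tight′ : Fin n → Set
    Tight′ = Tight E k

  Outcome : Set
  Outcome = Exceptional k E ⊎ Σ (Edge n) λ e → Σ (Edge n) λ f → CoveringPair E k e f

  private
    tight? : ∀ v → Dec (Tight′ v)
    tight? v = deg E v + k ≟ m

    tight-deg≡ : ∀ {u w} → Tight′ u → Tight′ w → deg E u ≡ deg E w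
    tight-deg≡ tu tw = +-cancelʳ-≡ k _ _ (trans tu (sym tw))

    deg≤tight : ∀ {u} z → Tight′ u → deg E z ≤ deg E u
    deg≤tight z tu = +-cancelʳ-≤ k _ _ (subst (deg E z + k ≤_) (sym tu) (deg≤ z))

    k≤tight : ∀ {u} → Tight′ u → k ≤ deg E u
    k≤tight {u} tu = +-cancelʳ-≤ k k (deg E u) (subst₂ _≤_ (2*n≡n+n k) (sym tu) 2k≤m)

    tight⇒deg<m : ∀ {u} → Tight′ u → deg E u < m
    tight⇒deg<m {u} tu = subst (deg E u <_) tu (m<m+n (deg E u) 1≤k)

    ends≤2 : ∀ {u p q} → u ≢ p → u ≢ q → both E u p + both E u q ≤ 2
    ends≤2 u≢p u≢q = +-mono-≤ (both≤1 simple u≢p) (both≤1 simple u≢q)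

    ¬incident⇒ends≤2 : ∀ {u g} → ¬ Incident u g → both E u (proj₁ g) + both E u (proj₂ g) ≤ 2
    ¬incident⇒ends≤2 ¬ug = ends≤2 (¬incident⇒≢ ¬ug incident₁) (¬incident⇒≢ ¬ug incident₂)

    -- deg z ≤ deg u ≤ 2 ≤ deg z.
    neighbour-tight : ∀ {u z g} → Tight′ u → deg E u ≤ 2 → g ∈ E → ¬ Incident u g → Incident z g →
                      1 ≤ both E u z → Tight′ z
    neighbour-tight {u} {z} tu du≤2 g∈ ¬ug zg 1≤uz =
      trans (cong (_+ k) (≤-antisym (deg≤tight z tu) (≤-trans du≤2 2≤dz))) tu
      where
      2≤dz : 2 ≤ deg E z
      2≤dz = deg≥2-via simple (both≥1⇒Adj simple 1≤uz (¬incident⇒≢ ¬ug zg)) g∈ zg ¬ug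

    covering : ∀ {e f} → e ∈ E → f ∈ E → Independent e f → (∀ v → Tight′ v → Incident v e ⊎ Incident v f) → Outcome
    covering e∈ f∈ e⊥f covers = inj₂ (_ , _ , (e∈ , f∈ , e⊥f) , covers)

    covers-or-misses : ∀ e f → (∀ v → Tight′ v → Incident v e ⊎ Incident v f) ⊎
                               Σ (Fin n) λ x → Tight′ x × ¬ Incident x e × ¬ Incident x f
    covers-or-misses e f with any? (λ x → tight? x ×-dec (¬? (incident? x e) ×-dec ¬? (incident? x f)))
    ... | yes (x , tx , ¬xe , ¬xf) = inj₂ (x , tx , ¬xe , ¬xf)
    ... | no none = inj₁ covers
      where
      covers : ∀ v → Tight′ v → Incident v e ⊎ Incident v f
      covers v tv with incident? v e | incident? v f
      ... | yes ve | _ = inj₁ ve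
      ... | no _ | yes vf = inj₂ vf
      ... | no ¬ve | no ¬vf = ⊥-elim (none (v , tv , ¬ve , ¬vf))

    ThirdTight : Fin n → Fin n → Set
    ThirdTight u w = Σ (Fin n) λ x → Tight′ x × x ≢ u × x ≢ w

    third-tight? : ∀ u w → Dec (ThirdTight u w)
    third-tight? u w = any? (λ x → tight? x ×-dec (¬? (x ≟ᶠ u) ×-dec ¬? (x ≟ᶠ w)))

    only-tight : ∀ {u w} → ¬ ThirdTight u w → ∀ v → Tight′ v → v ≡ u ⊎ v ≡ w
    only-tight {u} {w} none v tv with v ≟ᶠ u | v ≟ᶠ w
    ... | yes v≡u | _ = inj₁ v≡u
    ... | no _ | yes v≡w = inj₂ v≡w
    ... | no v≢u | no v≢w = ⊥-elim (none (v , tv , v≢u , v≢w))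

    at : ∀ {u v} {h : Edge n} → v ≡ u → Incident u h → Incident v h
    at refl uh = uh

  no-tight : (∀ v → ¬ Tight′ v) → Outcome
  no-tight ¬tight with length>0⇒∃∈ {xs = E} (≤-trans 1≤k (≤-trans (m≤m+n k (k + 0)) 2k≤m))
  ... | (x , y) , xy∈ with deg E x + deg E y ≤? m
  ...   | yes dx+dy≤m with count<length⇒∃∁ _ E either<m
    where
    either<m : either E x y < m
    either<m = ≤-trans (subst (_≤ either E x y + both E x y) (+-comm (either E x y) 1)
                                (+-monoʳ-≤ (either E x y) (Adj⇒both≥1 (inj₁ xy∈))))
                       (≤-trans (≤-reflexive (either+both E x y)) dx+dy≤m)
  ...     | h , h∈ , ¬h =
    covering h∈ xy∈ (¬incident⇒independent (λ xh → ¬h (inj₁ xh)) (λ yh → ¬h (inj₂ yh))) (λ v tv → ⊥-elim (¬tight v tv))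
  no-tight ¬tight | (x , y) , xy∈ | no m<dx+dy with count<length⇒∃∁ _ E dx<m
    where
    dx<m : deg E x < m
    dx<m = ≤-trans (s≤s (m≤m+n (deg E x) k)) (≤∧≢⇒< (deg≤ x) (¬tight x))
  ...     | g , g∈ , ¬xg with avoiding-edge-or-deg≤ E x (proj₁ g) (proj₂ g)
  ...       | inj₁ (h , h∈ , _ , ¬g₁h , ¬g₂h) =
    covering h∈ g∈ (¬incident⇒independent ¬g₁h ¬g₂h) (λ v tv → ⊥-elim (¬tight v tv))
  ...       | inj₂ dx≤ = ⊥-elim (<-irrefl refl (≤-trans 3≤dx (≤-trans dx≤ (¬incident⇒ends≤2 ¬xg))))
    where
    -- deg y ≤ m - k - 1 ≤ m - 2, so deg x > m - deg y ≥ 2.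
    3≤dx : 3 ≤ deg E x
    3≤dx = +-cancelʳ-≤ (deg E y) 3 (deg E x)
             (≤-trans (s≤s (s≤s (subst (_≤ deg E y + k) (+-comm (deg E y) 1) (+-monoʳ-≤ (deg E y) 1≤k))))
             (≤-trans (s≤s (≤∧≢⇒< (deg≤ y) (¬tight y))) (≰⇒> m<dx+dy)))

  one-tight : ∀ {u} → Tight′ u → (∀ v → Tight′ v → v ≡ u) → Outcome
  one-tight {u} tu only-u with count<length⇒∃∁ _ E (tight⇒deg<m tu)
  ... | g , g∈ , ¬ug with avoiding-edge-or-deg≤ E u (proj₁ g) (proj₂ g)
  ...   | inj₁ (h , h∈ , uh , ¬g₁h , ¬g₂h) =
    covering h∈ g∈ (¬incident⇒independent ¬g₁h ¬g₂h) (λ v tv → inj₁ (at (only-u v tv) uh))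
  ...   | inj₂ du≤ =
    ⊥-elim ([ ¬adjacent incident₁ , ¬adjacent incident₂ ]′ (1≤+⇒ _ _ (≤-trans (≤-trans 1≤k (k≤tight tu)) du≤)))
    where
    -- An endpoint of g adjacent to u would be a second tight vertex.
    ¬adjacent : ∀ {z} → Incident z g → ¬ 1 ≤ both E u z
    ¬adjacent zg 1≤ = ¬incident⇒≢ ¬ug zg (sym (only-u _ (neighbour-tight tu (≤-trans du≤ (¬incident⇒ends≤2 ¬ug)) g∈ ¬ug zg 1≤)))

  module NonAdjacentWithThird {s t x} (ts : Tight′ s) (tt : Tight′ t) (tx : Tight′ x) (s≢t : s ≢ t) (x≢s : x ≢ s)
                              (x≢t : x ≢ t) (st≡0 : both E s t ≡ 0) (spanning : ∀ {g} → g ∈ E → Incident s g ⊎ Incident t g)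
                              (sx : Adj E s x) (ds≡k : deg E s ≡ k) where

    private
      dt≡k : deg E t ≡ k
      dt≡k = trans (tight-deg≡ tt ts) ds≡k

      dx≡k : deg E x ≡ k
      dx≡k = trans (tight-deg≡ tx ts) ds≡k

      ts≡0 : both E t s ≡ 0
      ts≡0 = trans (both-sym E t s) st≡0

      1≤both : ∀ {z} → z ≢ s → z ≢ t → 2 ≤ deg E z → 1 ≤ both E z t
      1≤both z≢s z≢t 2≤dz = proj₂ (2≤+⇒ (≤-trans 2≤dz (deg≤both+both E _ s t λ g∈ _ → spanning g∈))
                                       (both≤1 simple z≢s) (both≤1 simple z≢t))

    outcome : Outcome
    outcome with Adj⇒Joins sx
    ... | e , e∈ , e-sx with avoiding-edge-or-deg≤ E t s x
    ...   | inj₂ dt≤ = ⊥-elim (<-irrefl refl (≤-trans 2≤dx (subst (_≤ 1) (sym (trans dx≡k (sym dt≡k))) dt≤1)))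
      where
      dt≤tx : deg E t ≤ both E t x
      dt≤tx = subst (λ z → deg E t ≤ z + both E t x) ts≡0 dt≤
      dt≤1 : deg E t ≤ 1
      dt≤1 = ≤-trans dt≤tx (both≤1 simple (≢-sym x≢t))
      2≤dx : 2 ≤ deg E x
      2≤dx = deg≥2-via simple (both≥1⇒Adj simple (≤-trans (≤-trans 1≤k (≤-reflexive (sym dt≡k))) dt≤tx) (≢-sym x≢t))
               e∈ (joins-incident₂ e-sx) (joins-¬incident e-sx (≢-sym s≢t) (≢-sym x≢t))
    ...   | inj₁ (h , h∈ , th , ¬sh , ¬xh) with covers-or-misses e h
    ...     | inj₁ covers = covering e∈ h∈ (independent-sym (¬incident-joins⇒independent ¬sh ¬xh e-sx)) covers
    ...     | inj₂ (y , ty , ¬ye , ¬yh) = ⊥-elim contradiction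
      where
      y≢s : y ≢ s
      y≢s = ¬incident⇒≢ ¬ye (joins-incident₁ e-sx)
      y≢x : y ≢ x
      y≢x = ¬incident⇒≢ ¬ye (joins-incident₂ e-sx)
      y≢t : y ≢ t
      y≢t = ¬incident⇒≢ ¬yh th
      dy≡k : deg E y ≡ k
      dy≡k = trans (tight-deg≡ ty ts) ds≡k
      k≤2 : k ≤ 2
      k≤2 = ≤-trans (≤-reflexive (sym dy≡k)) (≤-trans (deg≤both+both E y s t λ g∈ _ → spanning g∈) (ends≤2 y≢s y≢t))
      k≡2 : k ≢ 1 → k ≡ 2
      k≡2 k≢1 = ≤-antisym k≤2 (≤∧≢⇒< 1≤k (≢-sym k≢1))
      contradiction : ⊥
      contradiction with k ≟ 1
      ... | yes k≡1 with count>0⇒∃ (incident? y) E (≤-trans 1≤k (≤-reflexive (sym dy≡k)))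
      ...   | g , g∈ , yg = <-irrefl refl (≤-trans 3≤m (≤-reflexive m≡2))
        where
        -- m = deg s + k = 2, yet e, h and an edge at y are three different edges.
        m≡2 : m ≡ 2
        m≡2 = trans (sym ts) (trans (cong (_+ k) ds≡k) (cong (λ z → z + z) k≡1))
        3≤m : 3 ≤ m
        3≤m = unique-⊆⇒length≤ {xs = e ∷ h ∷ g ∷ []}
          ((independent⇒≢ (independent-sym (¬incident-joins⇒independent ¬sh ¬xh e-sx)) ∷ ≢-sym (incident⇒≢ yg ¬ye) ∷ [])
           ∷ (≢-sym (incident⇒≢ yg ¬yh) ∷ []) ∷ [] ∷ [])
          λ { (here refl) → e∈ ; (there (here refl)) → h∈ ; (there (there (here refl))) → g∈ }
      contradiction | no k≢1 with Adj⇒Joins (both≥1⇒Adj simple (1≤both y≢s y≢t (≤-reflexive (sym (trans dy≡k (k≡2 k≢1))))) y≢t)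
                      | Adj⇒Joins (both≥1⇒Adj simple (1≤both x≢s x≢t (≤-reflexive (sym (trans dx≡k (k≡2 k≢1))))) x≢t)
      ...   | gy , gy∈ , gy-yt | gx , gx∈ , gx-xt = <-irrefl refl (≤-trans 3≤dt (≤-reflexive (trans dt≡k (k≡2 k≢1))))
        where
        -- t would need the three edges h, ty and tx.
        3≤dt : 3 ≤ deg E t
        3≤dt = unique-⊆-count≥ (incident? t) {ys = h ∷ gy ∷ gx ∷ []}
          ((≢-sym (incident⇒≢ (joins-incident₁ gy-yt) ¬yh) ∷ ≢-sym (incident⇒≢ (joins-incident₁ gx-xt) ¬xh) ∷ [])
           ∷ (incident⇒≢ (joins-incident₁ gy-yt) (joins-¬incident gx-xt y≢x y≢t) ∷ []) ∷ [] ∷ [])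
          λ { (here refl) → h∈ , th ; (there (here refl)) → gy∈ , joins-incident₂ gy-yt
            ; (there (there (here refl))) → gx∈ , joins-incident₂ gx-xt }

  module NonAdjacent {u w} (tu : Tight′ u) (tw : Tight′ w) (u≢w : u ≢ w) (uw≡0 : both E u w ≡ 0) where

    private
      dw≡du : deg E w ≡ deg E u
      dw≡du = tight-deg≡ tw tu

      either≡2du : either E u w ≡ deg E u + deg E u
      either≡2du = trans (sym (+-identityʳ _)) (trans (cong (either E u w +_) (sym uw≡0))
                     (trans (either+both E u w) (cong (deg E u +_) dw≡du)))

    -- The 2 deg u edges at u or w fit into m = deg u + k, so deg u ≤ k.
    du≡k : deg E u ≡ k
    du≡k = ≤-antisym (+-cancelˡ-≤ (deg E u) (deg E u) k
                       (≤-trans (≤-reflexive (sym either≡2du)) (≤-trans (length-filter _ E) (≤-reflexive (sym tu)))))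
                     (k≤tight tu)

    spanning : ∀ {g} → g ∈ E → Incident u g ⊎ Incident w g
    spanning = All.lookup (count≡length⇒All _ (trans either≡2du (trans (cong (deg E u +_) du≡k) tu)))

    outcome : Outcome
    outcome with third-tight? u w
    ... | yes (x , tx , x≢u , x≢w) with 1≤+⇒ (both E x u) (both E x w)
           (≤-trans (≤-trans 1≤k (≤-reflexive (sym (trans (tight-deg≡ tx tu) du≡k)))) (deg≤both+both E x u w λ g∈ _ → spanning g∈))
    ...   | inj₁ 1≤xu = NonAdjacentWithThird.outcome tu tw tx u≢w x≢u x≢w uw≡0 spanning
                          (Adj-sym (both≥1⇒Adj simple 1≤xu x≢u)) du≡k
    ...   | inj₂ 1≤xw = NonAdjacentWithThird.outcome tw tu tx (≢-sym u≢w) x≢w x≢u (trans (both-sym E w u) uw≡0) spanning′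
                          (Adj-sym (both≥1⇒Adj simple 1≤xw x≢w)) (trans dw≡du du≡k)
      where
      spanning′ : ∀ {g} → g ∈ E → Incident w g ⊎ Incident u g
      spanning′ g∈ with spanning g∈
      ... | inj₁ ug = inj₂ ug
      ... | inj₂ wg = inj₁ wg
    outcome | no none with count>0⇒∃ (incident? u) E (≤-trans 1≤k (≤-reflexive (sym du≡k)))
    ... | e , e∈ , ue with incident⇒joins ue
    ...   | z , e-uz with avoiding-edge-or-deg≤ E w u z
    ...     | inj₁ (h , h∈ , wh , ¬uh , ¬zh) =
              covering e∈ h∈ (independent-sym (¬incident-joins⇒independent ¬uh ¬zh e-uz)) covers
      where
      covers : ∀ v → Tight′ v → Incident v e ⊎ Incident v h
      covers v tv with only-tight none v tv
      ... | inj₁ v≡u = inj₁ (at v≡u ue)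
      ... | inj₂ v≡w = inj₂ (at v≡w wh)
    ...     | inj₂ dw≤ = ⊥-elim (<-irrefl refl (≤-trans 2≤dz (≤-trans (deg≤tight z tw) dw≤1)))
      where
      ¬we : ¬ Incident w e
      ¬we we with () ← subst (1 ≤_) uw≡0 (incident⇒both≥1 e∈ ue we)
      dw≤wz : deg E w ≤ both E w z
      dw≤wz = subst (λ c → deg E w ≤ c + both E w z) (trans (both-sym E w u) uw≡0) dw≤
      dw≤1 : deg E w ≤ 1
      dw≤1 = ≤-trans dw≤wz (both≤1 simple (¬incident⇒≢ ¬we (joins-incident₂ e-uz)))
      2≤dz : 2 ≤ deg E z
      2≤dz = deg≥2-via simple (both≥1⇒Adj simple (≤-trans (≤-trans 1≤k (≤-reflexive (sym (trans dw≡du du≡k)))) dw≤wz)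
                                 (¬incident⇒≢ ¬we (joins-incident₂ e-uz)))
               e∈ (joins-incident₂ e-uz) ¬we

  module AdjacentSpanning {u w} (tu : Tight′ u) (tw : Tight′ w) (u≢w : u ≢ w) (1≤uw : 1 ≤ both E u w)
                          (either≡m : either E u w ≡ m) where

    private
      uw≡1 : both E u w ≡ 1
      uw≡1 = ≤-antisym (both≤1 simple u≢w) 1≤uw

    du≡1+k : deg E u ≡ suc k
    du≡1+k = +-cancelˡ-≡ (deg E u) _ _ (begin
      deg E u + deg E u          ≡⟨ cong (deg E u +_) (tight-deg≡ tu tw) ⟩
      deg E u + deg E w          ≡⟨ either+both E u w ⟨
      either E u w + both E u w  ≡⟨ cong₂ _+_ either≡m uw≡1 ⟩
      m + 1                      ≡⟨ cong (_+ 1) tu ⟨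
      deg E u + k + 1            ≡⟨ +-assoc (deg E u) k 1 ⟩
      deg E u + (k + 1)          ≡⟨ cong (deg E u +_) (+-comm k 1) ⟩
      deg E u + suc k            ∎)
      where open ≡-Reasoning

    -- Their degrees sum to m + 1, while either ≤ m and both ≤ 1.
    tight-pair : ∀ {s t} → s ≢ t → Tight′ s → Tight′ t → Adj E s t × (∀ {g} → g ∈ E → Incident s g ⊎ Incident t g)
    tight-pair {s} {t} s≢t ts tt with either+both≡1+m
      where
      either+both≡1+m : either E s t + both E s t ≡ suc m
      either+both≡1+m = begin
        either E s t + both E s t  ≡⟨ either+both E s t ⟩
        deg E s + deg E t          ≡⟨ cong₂ _+_ (trans (tight-deg≡ ts tu) du≡1+k) (trans (tight-deg≡ tt tu) du≡1+k) ⟩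
        suc k + suc k              ≡⟨ cong suc (+-suc k k) ⟩
        suc (suc k + k)            ≡⟨ cong (λ d → suc (d + k)) du≡1+k ⟨
        suc (deg E u + k)          ≡⟨ cong suc tu ⟩
        suc m                      ∎
        where open ≡-Reasoning
    ... | eq with m≤n⇒m<n∨m≡n (length-filter (λ g → incident? s g ⊎-dec incident? t g) E)
    ...   | inj₂ either≡m′ = both≥1⇒Adj simple (≤-reflexive (sym st≡1)) s≢t , All.lookup (count≡length⇒All _ either≡m′)
      where
      st≡1 : both E s t ≡ 1
      st≡1 = +-cancelˡ-≡ m _ _ (trans (cong (_+ both E s t) (sym either≡m′)) (trans eq (sym (+-comm m 1))))
    ...   | inj₁ either<m = ⊥-elim (<-irrefl refl (≤-trans (≤-reflexive (cong suc (sym eq)))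
                                    (≤-trans (+-mono-≤ either<m (both≤1 simple s≢t)) (≤-reflexive (+-comm m 1)))))

    outcome : Outcome
    outcome with third-tight? u w
    ... | yes (x , tx , x≢u , x≢w) with tight-pair (≢-sym x≢u) tu tx | tight-pair (≢-sym x≢w) tw tx
    ...   | ux , _ | wx , spanning-wx with avoiding-edge-or-deg≤ E u w x
    ...     | inj₁ (h , h∈ , _ , ¬wh , ¬xh) with spanning-wx h∈
    ...       | inj₁ wh = ⊥-elim (¬wh wh)
    ...       | inj₂ xh = ⊥-elim (¬xh xh)
    outcome | yes (x , tx , x≢u , x≢w) | ux , _ | wx , _ | inj₂ du≤ =
      inj₁ (inj₁ (k≡1 , u , w , x , (((u≢w ∷ ≢-sym x≢u ∷ []) ∷ (≢-sym x≢w ∷ []) ∷ [] ∷ []) ,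
                  both≥1⇒Adj simple 1≤uw u≢w , wx , ux) , m≡3))
      where
      k≡1 : k ≡ 1
      k≡1 = ≤-antisym (≤-pred (≤-trans (≤-reflexive (sym du≡1+k)) (≤-trans du≤ (ends≤2 u≢w (≢-sym x≢u))))) 1≤k
      m≡3 : m ≡ 3
      m≡3 = trans (sym tu) (cong₂ _+_ (trans du≡1+k (cong suc k≡1)) k≡1)
    outcome | no none with count<length⇒∃∁ (incident? u) (filter (incident? w) E) u<w
      where
      u<w : count (incident? u) (filter (incident? w) E) < deg E w
      u<w = subst₂ _<_ (sym (trans (count-filter (incident? u) (incident? w) E) uw≡1))
                       (sym (trans (tight-deg≡ tw tu) du≡1+k)) (s≤s 1≤k)
    ... | g , g∈w , ¬ug with ∈-filter⁻ (incident? w) {xs = E} g∈w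
    ...   | g∈ , wg with incident⇒joins wg
    ...     | z , g-wz with avoiding-edge-or-deg≤ E u w z
    ...       | inj₁ (h , h∈ , uh , ¬wh , ¬zh) = covering h∈ g∈ (¬incident-joins⇒independent ¬wh ¬zh g-wz) covers
      where
      covers : ∀ v → Tight′ v → Incident v h ⊎ Incident v g
      covers v tv with only-tight none v tv
      ... | inj₁ v≡u = inj₁ (at v≡u uh)
      ... | inj₂ v≡w = inj₂ (at v≡w wg)
    ...       | inj₂ du≤ = ⊥-elim (none (z , tz , ≢-sym (¬incident⇒≢ ¬ug (joins-incident₂ g-wz)) , ≢-sym (Joins⇒≢ simple g∈ g-wz)))
      where
      -- deg u = k + 1 ≥ 2 forces u to be adjacent to z as well.
      du≤2 : deg E u ≤ 2
      du≤2 = ≤-trans du≤ (ends≤2 u≢w (¬incident⇒≢ ¬ug (joins-incident₂ g-wz)))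
      1≤uz : 1 ≤ both E u z
      1≤uz = proj₂ (2≤+⇒ (≤-trans (s≤s 1≤k) (≤-trans (≤-reflexive (sym du≡1+k)) du≤))
                         (both≤1 simple u≢w) (both≤1 simple (¬incident⇒≢ ¬ug (joins-incident₂ g-wz))))
      tz : Tight′ z
      tz = neighbour-tight tu du≤2 g∈ ¬ug (joins-incident₂ g-wz) 1≤uz

  module AdjacentNotSpanning {u w} (tu : Tight′ u) (tw : Tight′ w) (u≢w : u ≢ w) (1≤uw : 1 ≤ both E u w)
                             (either≢m : either E u w ≢ m) where

    private
      misses-uw? : Decidable λ g → ¬ (Incident u g ⊎ Incident w g)
      misses-uw? g = ¬? (incident? u g ⊎-dec incident? w g)

      uw≡1 : both E u w ≡ 1
      uw≡1 = ≤-antisym (both≤1 simple u≢w) 1≤uw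

      either+1≡2du : either E u w + 1 ≡ deg E u + deg E u
      either+1≡2du = trans (cong (either E u w +_) (sym uw≡1)) (trans (either+both E u w) (cong (deg E u +_) (tight-deg≡ tw tu)))

    -- 2 deg u - 1 = either < m = deg u + k, so deg u = k, m = 2k and exactly one edge misses u and w.
    du≡k : deg E u ≡ k
    du≡k = ≤-antisym (+-cancelˡ-≤ (deg E u) (deg E u) k
                       (≤-trans (≤-reflexive (sym either+1≡2du))
                          (≤-trans (subst (_≤ m) (+-comm 1 _) (≤∧≢⇒< (length-filter _ E) either≢m)) (≤-reflexive (sym tu)))))
                     (k≤tight tu)

    m≡2du : m ≡ deg E u + deg E u
    m≡2du = trans (sym tu) (cong (deg E u +_) (sym du≡k))

    avoiding≤1 : count misses-uw? E ≤ 1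
    avoiding≤1 = +-cancelˡ-≤ (either E u w) _ 1
                   (≤-reflexive (trans (count+count-∁ _ E) (trans m≡2du (sym either+1≡2du))))

    outcome : Outcome
    outcome with Adj⇒Joins (both≥1⇒Adj simple 1≤uw u≢w)
               | count<length⇒∃∁ _ E (≤∧≢⇒< (length-filter _ E) either≢m)
    ... | e , e∈ , e-uw | f , f∈ , ¬uwf with covers-or-misses e f
    ...   | inj₁ covers = covering e∈ f∈ (independent-sym (¬incident-joins⇒independent (λ uf → ¬uwf (inj₁ uf))
                                                                                    (λ wf → ¬uwf (inj₂ wf)) e-uw)) covers
    ...   | inj₂ (x , tx , ¬xe , ¬xf) =
      inj₁ (inj₂ (k≡2 , u , w , x , proj₁ f , proj₂ f ,
        ((u≢w ∷ ≢-sym x≢u ∷ u≢f incident₁ ∷ u≢f incident₂ ∷ []) ∷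
         (≢-sym x≢w ∷ w≢f incident₁ ∷ w≢f incident₂ ∷ []) ∷
         (¬incident⇒≢ ¬xf incident₁ ∷ ¬incident⇒≢ ¬xf incident₂ ∷ []) ∷
         (canonical⇒≢ (canonical simple f∈) ∷ []) ∷ [] ∷ []) ,
        both≥1⇒Adj simple 1≤uw u≢w , Adj-sym (both≥1⇒Adj simple 1≤xw x≢w) , Adj-sym (both≥1⇒Adj simple 1≤xu x≢u) ,
        inj₁ f∈ , trans m≡2du (cong (λ d → d + d) (trans du≡k k≡2))))
      where
      x≢u : x ≢ u
      x≢u = ¬incident⇒≢ ¬xe (joins-incident₁ e-uw)
      x≢w : x ≢ w
      x≢w = ¬incident⇒≢ ¬xe (joins-incident₂ e-uw)
      u≢f : ∀ {z} → Incident z f → u ≢ z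
      u≢f zf refl = ¬uwf (inj₁ zf)
      w≢f : ∀ {z} → Incident z f → w ≢ z
      w≢f zf refl = ¬uwf (inj₂ zf)
      -- f is the only edge missing u and w, and it misses x; so all edges at x go to u or w.
      dx≤ : deg E x ≤ both E x u + both E x w
      dx≤ = deg≤both+both E x u w to-u-or-w
        where
        to-u-or-w : ∀ {g} → g ∈ E → Incident x g → Incident u g ⊎ Incident w g
        to-u-or-w {g} g∈ xg with incident? u g ⊎-dec incident? w g
        ... | yes uwg = uwg
        ... | no ¬uwg = ⊥-elim (¬xf (subst (Incident x) (count≤1⇒≡ misses-uw? _≟ₑ_ avoiding≤1 g∈ f∈ ¬uwg ¬uwf) xg))
      dx≡k : deg E x ≡ k
      dx≡k = trans (tight-deg≡ tx tu) du≡k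
      -- x has a neighbour in {u, w}, which also has the edge uw, so k ≥ 2.
      2≤k : 2 ≤ k
      2≤k with 1≤+⇒ (both E x u) (both E x w) (≤-trans (≤-trans 1≤k (≤-reflexive (sym dx≡k))) dx≤)
      ... | inj₁ 1≤xu = ≤-trans (deg≥2-via simple (both≥1⇒Adj simple 1≤xu x≢u) e∈ (joins-incident₁ e-uw) ¬xe)
                                 (≤-reflexive du≡k)
      ... | inj₂ 1≤xw = ≤-trans (deg≥2-via simple (both≥1⇒Adj simple 1≤xw x≢w) e∈ (joins-incident₂ e-uw) ¬xe)
                                 (≤-reflexive (trans (tight-deg≡ tw tu) du≡k))
      k≡2 : k ≡ 2
      k≡2 = ≤-antisym (≤-trans (≤-reflexive (sym dx≡k)) (≤-trans dx≤ (ends≤2 x≢u x≢w))) 2≤k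
      x-both : 1 ≤ both E x u × 1 ≤ both E x w
      x-both = 2≤+⇒ (≤-trans (≤-trans 2≤k (≤-reflexive (sym dx≡k))) dx≤) (both≤1 simple x≢u) (both≤1 simple x≢w)
      1≤xu : 1 ≤ both E x u
      1≤xu = proj₁ x-both
      1≤xw : 1 ≤ both E x w
      1≤xw = proj₂ x-both

  covering-step : Outcome
  covering-step with any? tight?
  ... | no none = no-tight λ v tv → none (v , tv)
  ... | yes (u , tu) with any? (λ w → tight? w ×-dec ¬? (w ≟ᶠ u))
  ...   | no none = one-tight tu only-u
    where
    only-u : ∀ v → Tight′ v → v ≡ u
    only-u v tv with v ≟ᶠ u
    ... | yes v≡u = v≡u
    ... | no v≢u = ⊥-elim (none (v , tv , v≢u))
  ...   | yes (w , tw , w≢u) with 1 ≤? both E u w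
  ...     | no ¬1≤ = NonAdjacent.outcome tu tw (≢-sym w≢u) (n≤0⇒n≡0 (≮⇒≥ ¬1≤))
  ...     | yes 1≤ with either E u w ≟ m
  ...       | yes either≡m = AdjacentSpanning.outcome tu tw (≢-sym w≢u) 1≤ either≡m
  ...       | no either≢m = AdjacentNotSpanning.outcome tu tw (≢-sym w≢u) 1≤ either≢m

-- Building a packing pair by pair

private
  halve-bound : ∀ k m m′ → 2 * suc k ≤ m → m ≤ m′ + 2 → 2 * k ≤ m′
  halve-bound k m m′ 2k+2≤m m≤m′+2 = +-cancelʳ-≤ 2 (2 * k) m′ (subst (_≤ m′ + 2) (shift k) (≤-trans 2k+2≤m m≤m′+2))
    where
    shift : ∀ k → 2 * suc k ≡ 2 * k + 2
    shift = solve-∀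

  drop-bound : ∀ d k m′ → d + suc (suc k) ≤ m′ + 2 → d + k ≤ m′
  drop-bound d k m′ le = +-cancelʳ-≤ 2 (d + k) m′ (subst (_≤ m′ + 2) (shift d k) le)
    where
    shift : ∀ d k → d + suc (suc k) ≡ d + k + 2
    shift = solve-∀

packing-or-exceptional : ∀ {n} k {E : List (Edge n)} → Simple E → 2 * k ≤ length E → (∀ v → deg E v + k ≤ length E) →
                         Exceptional k E ⊎ Packing E k
packing-or-exceptional zero _ _ _ = inj₂ ([] , [] , [] , refl)
packing-or-exceptional (suc k) {E} simple 2k≤m deg≤ with covering-step simple (suc k) (s≤s z≤n) 2k≤m deg≤
... | inj₁ exceptional = inj₁ exceptional
... | inj₂ (e , f , (e∈ , f∈ , e⊥f) , covers)
    with packing-or-exceptional k (∖-simple simple) (halve-bound k _ _ 2k≤m (∖-length simple)) deg′≤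
  where
  -- Every vertex loses a unit of slack: tight ones through e or f, the others had slack to spare.
  deg′<deg : ∀ v → Tight E (suc k) v → deg (E ∖[ e , f ]) v < deg E v
  deg′<deg v tight with covers v tight
  ... | inj₁ ve = ∖-deg< {E = E} v e∈ ve λ (e≢e , _) → e≢e refl
  ... | inj₂ vf = ∖-deg< {E = E} v f∈ vf λ (_ , f≢f) → f≢f refl
  deg′+2≤ : ∀ v → deg (E ∖[ e , f ]) v + suc (suc k) ≤ length E
  deg′+2≤ v with deg E v + suc k ≟ length E
  ... | no ¬tight = ≤-trans (+-monoˡ-≤ _ (∖-deg≤ {E = E} v)) (subst (_≤ length E) (sym (+-suc _ _)) (≤∧≢⇒< (deg≤ v) ¬tight))
  ... | yes tight = ≤-trans (subst (_≤ deg E v + suc k) (sym (+-suc _ _)) (+-monoˡ-≤ _ (deg′<deg v tight))) (deg≤ v)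
  deg′≤ : ∀ v → deg (E ∖[ e , f ]) v + k ≤ length (E ∖[ e , f ])
  deg′≤ v = drop-bound _ k _ (≤-trans (deg′+2≤ v) (∖-length simple))
... | inj₁ (inj₁ (refl , K₃)) = inj₂ (K₃-residual⇒packing simple e∈ f∈ e⊥f K₃)
... | inj₁ (inj₂ (refl , K₃∪K₂)) = inj₂ (K₃∪K₂-residual⇒packing simple e∈ f∈ e⊥f K₃∪K₂)
... | inj₂ (ps , ps∈ , unique , refl) =
      inj₂ ((e , f) ∷ ps , (e∈ , f∈ , e⊥f) ∷ All.map weaken ps∈ ,
            (independent⇒≢ e⊥f ∷ All.map (λ g∈ → ≢-sym (≢e g∈)) edges∈) ∷
            All.map (λ g∈ → ≢-sym (≢f g∈)) edges∈ ∷ unique ,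
            refl)
  where
  ∈E : ∀ {g} → g ∈ E ∖[ e , f ] → g ∈ E
  ∈E g∈ = proj₁ (∈-∖⁻ {E = E} g∈)
  ≢e : ∀ {g} → g ∈ E ∖[ e , f ] → g ≢ e
  ≢e g∈ = proj₁ (proj₂ (∈-∖⁻ {E = E} g∈))
  ≢f : ∀ {g} → g ∈ E ∖[ e , f ] → g ≢ f
  ≢f g∈ = proj₂ (proj₂ (∈-∖⁻ {E = E} g∈))
  weaken : ∀ {p} → EdgePairIn (E ∖[ e , f ]) p → EdgePairIn E p
  weaken (g∈ , h∈ , g⊥h) = ∈E g∈ , ∈E h∈ , g⊥h
  edges∈ : All (_∈ E ∖[ e , f ]) (edgesOf ps)
  edges∈ = edgesOf-⊆ ps∈

-- The edge list of a graph

module _ {A : Set} (f : A → ℕ) where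

  ≤-foldr-⊔ : ∀ xs {x} → x ∈ xs → f x ≤ foldr _⊔_ 0 (map f xs)
  ≤-foldr-⊔ (y ∷ ys) (here refl) = m≤m⊔n _ _
  ≤-foldr-⊔ (y ∷ ys) (there x∈) = ≤-trans (≤-foldr-⊔ ys x∈) (m≤n⊔m _ _)

  foldr-⊔-attained : ∀ xs → foldr _⊔_ 0 (map f xs) ≡ 0 ⊎ Σ A λ x → x ∈ xs × f x ≡ foldr _⊔_ 0 (map f xs)
  foldr-⊔-attained [] = inj₁ refl
  foldr-⊔-attained (y ∷ ys) with ⊔-sel (f y) (foldr _⊔_ 0 (map f ys))
  ... | inj₁ max≡fy = inj₂ (y , here refl , sym max≡fy)
  ... | inj₂ max≡rest with foldr-⊔-attained ys
  ...   | inj₁ rest≡0 = inj₁ (trans max≡rest rest≡0)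
  ...   | inj₂ (x , x∈ , fx≡) = inj₂ (x , there x∈ , trans fx≡ (sym max≡rest))

module _ {n : ℕ} (G : Graph n) where

  private
    isEdge? : Decidable λ p → isEdge G p ≡ true
    isEdge? p = isEdge G p ≟ᵇ true

    adj? : ∀ v → Decidable λ j → adj G v j ≡ true
    adj? v j = adj G v j ≟ᵇ true

  -- numEdges G reduces to length edges.
  edges : List (Edge n)
  edges = filter isEdge? (pairs n)

  ∈edges⁻ : ∀ {e} → e ∈ edges → IsEdge G e
  ∈edges⁻ {i , j} e∈ with toℕ i <? toℕ j | proj₂ (∈-filter⁻ isEdge? {xs = pairs n} e∈)
  ... | yes i<j | adj≡true = i<j , adj≡true
  ... | no _ | ()

  ∈edges⁺ : ∀ {i j} → IsEdge G (i , j) → (i , j) ∈ edges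
  ∈edges⁺ {i} {j} (i<j , adj≡true) = ∈-filter⁺ isEdge? (∈-cartesianProduct⁺ (∈-allFin i) (∈-allFin j)) isEdge≡true
    where
    isEdge≡true : isEdge G (i , j) ≡ true
    isEdge≡true with toℕ i <? toℕ j
    ... | yes _ = adj≡true
    ... | no i≮j = ⊥-elim (i≮j i<j)

  edges-simple : Simple edges
  edges-simple = All.tabulate (λ e∈ → proj₁ (∈edges⁻ e∈)) ,
                 Unique.filter⁺ isEdge? (Unique.cartesianProduct⁺ (Unique.allFin⁺ n) (Unique.allFin⁺ n))

  adj⇒≢ : ∀ {i j} → adj G i j ≡ true → i ≢ j
  adj⇒≢ {i} adj≡true refl with () ← trans (sym adj≡true) (irrefl G i)

  edgeBetween∈edges : ∀ {v j} → adj G v j ≡ true → edgeBetween v j ∈ edges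
  edgeBetween∈edges {v} {j} adj≡true with toℕ v <? toℕ j
  ... | yes v<j = ∈edges⁺ (v<j , adj≡true)
  ... | no v≮j =
    ∈edges⁺ (≤∧≢⇒< (≮⇒≥ v≮j) (λ j≡v → adj⇒≢ adj≡true (toℕ-injective (sym j≡v))) , trans (adj-sym G j v) adj≡true)

  adj⇒Adj : ∀ {i j} → adj G i j ≡ true → Adj edges i j
  adj⇒Adj {i} {j} adj≡true with toℕ i <? toℕ j | edgeBetween∈edges adj≡true
  ... | yes _ | e∈ = inj₁ e∈
  ... | no _ | e∈ = inj₂ e∈

  Adj⇒adj : ∀ {i j} → Adj edges i j → adj G i j ≡ true
  Adj⇒adj (inj₁ e∈) = proj₂ (∈edges⁻ e∈)
  Adj⇒adj {i} {j} (inj₂ e∈) = trans (adj-sym G i j) (proj₂ (∈edges⁻ e∈))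

  private
    neighbours : Fin n → List (Fin n)
    neighbours v = filter (adj? v) (allFin n)

    other : Fin n → Edge n → Fin n
    other v (x , y) with v ≟ᶠ x
    ... | yes _ = y
    ... | no _ = x

    other-edgeBetween : ∀ {v j} → j ≢ v → other v (edgeBetween v j) ≡ j
    other-edgeBetween {v} {j} j≢v with toℕ v <? toℕ j
    ... | yes _ with v ≟ᶠ v
    ...   | yes _ = refl
    ...   | no v≢v = ⊥-elim (v≢v refl)
    other-edgeBetween {v} {j} j≢v | no _ with v ≟ᶠ j
    ...   | yes v≡j = ⊥-elim (j≢v (sym v≡j))
    ...   | no _ = refl

    edgeBetween-other : ∀ {v e} → Canonical e → Incident v e → edgeBetween v (other v e) ≡ e
    edgeBetween-other {v} {x , y} x<y ve with v ≟ᶠ x | ve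
    ... | yes refl | _ with toℕ v <? toℕ y
    ...   | yes _ = refl
    ...   | no v≮y = ⊥-elim (v≮y x<y)
    edgeBetween-other {v} {x , y} x<y ve | no v≢x | inj₁ v≡x = ⊥-elim (v≢x v≡x)
    edgeBetween-other {v} {x , y} x<y ve | no v≢x | inj₂ refl with toℕ v <? toℕ x
    ...   | yes y<x = ⊥-elim (<-asym x<y y<x)
    ...   | no _ = refl

    adj-other : ∀ {v e} → e ∈ edges → Incident v e → adj G v (other v e) ≡ true
    adj-other {v} {x , y} e∈ ve with v ≟ᶠ x | ve
    ... | yes refl | _ = proj₂ (∈edges⁻ e∈)
    ... | no v≢x | inj₁ v≡x = ⊥-elim (v≢x v≡x)
    ... | no _ | inj₂ refl = trans (adj-sym G v x) (proj₂ (∈edges⁻ e∈))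

  -- Neighbours j of v correspond to the edges at v via j ↦ edgeBetween v j, with inverse other v.
  degree≡deg : ∀ v → degree G v ≡ deg edges v
  degree≡deg v = ≤-antisym degree≤deg deg≤degree
    where
    at-v : List (Edge n)
    at-v = filter (incident? v) edges
    adjacent : ∀ {j} → j ∈ neighbours v → adj G v j ≡ true
    adjacent j∈ = proj₂ (∈-filter⁻ (adj? v) {xs = allFin n} j∈)
    ∈at-v : ∀ {e} → e ∈ at-v → e ∈ edges × Incident v e
    ∈at-v e∈ = ∈-filter⁻ (incident? v) {xs = edges} e∈
    degree≤deg : degree G v ≤ deg edges v
    degree≤deg = subst (_≤ deg edges v) (length-map (edgeBetween v) (neighbours v))
      (unique-⊆⇒length≤
        (unique-map⁺ (edgeBetween v) (other v) (λ j∈ → other-edgeBetween (≢-sym (adj⇒≢ (adjacent j∈))))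
                     (Unique.filter⁺ (adj? v) (Unique.allFin⁺ n)))
        λ e∈ → let j , j∈ , e≡ = ∈-map⁻ (edgeBetween v) e∈ in
          subst (_∈ at-v) (sym e≡) (∈-filter⁺ (incident? v) (edgeBetween∈edges (adjacent j∈)) (edgeBetween-incident₁ v j)))
    deg≤degree : deg edges v ≤ degree G v
    deg≤degree = subst (_≤ degree G v) (length-map (other v) at-v)
      (unique-⊆⇒length≤
        (unique-map⁺ (other v) (edgeBetween v) (λ e∈ → edgeBetween-other (canonical edges-simple (proj₁ (∈at-v e∈))) (proj₂ (∈at-v e∈)))
                     (Unique.filter⁺ (incident? v) (proj₂ edges-simple)))
        λ j∈ → let e , e∈ , j≡ = ∈-map⁻ (other v) j∈ in
          subst (_∈ neighbours v) (sym j≡) (∈-filter⁺ (adj? v) (∈-allFin (other v e)) (adj-other (proj₁ (∈at-v e∈)) (proj₂ (∈at-v e∈)))))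

  deg≤maxDegree : ∀ v → deg edges v ≤ maxDegree G
  deg≤maxDegree v = subst (_≤ maxDegree G) (degree≡deg v) (≤-foldr-⊔ (degree G) (allFin n) (∈-allFin v))

  maxDegree-attained : maxDegree G ≡ 0 ⊎ Σ (Fin n) λ v → deg edges v ≡ maxDegree G
  maxDegree-attained with foldr-⊔-attained (degree G) (allFin n)
  ... | inj₁ max≡0 = inj₁ max≡0
  ... | inj₂ (v , _ , degree≡max) = inj₂ (v , trans (sym (degree≡deg v)) degree≡max)

-- Isomorphisms from embeddings

private
  transpose-here : ∀ {n} (i j : Fin n) → PC.transpose i j i ≡ j
  transpose-here i j with i ≟ᶠ i
  ... | yes _ = refl
  ... | no i≢i = ⊥-elim (i≢i refl)

  transpose-elsewhere : ∀ {n} (i j k : Fin n) → k ≢ i → k ≢ j → PC.transpose i j k ≡ k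
  transpose-elsewhere i j k k≢i k≢j with k ≟ᶠ i
  ... | yes k≡i = ⊥-elim (k≢i k≡i)
  ... | no _ with k ≟ᶠ j
  ...   | yes k≡j = ⊥-elim (k≢j k≡j)
  ...   | no _ = refl

permutation-injective : ∀ {n} (π : Permutation′ n) {x y} → π ⟨$⟩ʳ x ≡ π ⟨$⟩ʳ y → x ≡ y
permutation-injective π {x} {y} πx≡πy = trans (sym (inverseˡ π)) (trans (cong (π ⟨$⟩ˡ_) πx≡πy) (inverseˡ π))

injections-permutation : ∀ {n} r (σ ρ : Fin r → Fin n) → (∀ {s t} → σ s ≡ σ t → s ≡ t) →
                         (∀ {s t} → ρ s ≡ ρ t → s ≡ t) → Σ (Permutation′ n) λ π → ∀ t → π ⟨$⟩ʳ σ t ≡ ρ t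
injections-permutation zero σ ρ _ _ = id , λ ()
injections-permutation (suc r) σ ρ σ-inj ρ-inj
  with injections-permutation r (λ t → σ (suc t)) (λ t → ρ (suc t))
         (λ eq → Fin.suc-injective (σ-inj eq)) (λ eq → Fin.suc-injective (ρ-inj eq))
... | π , π∘σ≡ρ = π ∘ₚ transpose (π ⟨$⟩ʳ σ zero) (ρ zero) , maps
  where
  maps : ∀ t → PC.transpose (π ⟨$⟩ʳ σ zero) (ρ zero) (π ⟨$⟩ʳ σ t) ≡ ρ t
  maps zero = transpose-here (π ⟨$⟩ʳ σ zero) (ρ zero)
  maps (suc t) = trans (cong (PC.transpose _ _) (π∘σ≡ρ t)) (transpose-elsewhere _ _ (ρ (suc t)) ρ≢πσ₀ ρ≢ρ₀)
    where
    ρ≢πσ₀ : ρ (suc t) ≢ π ⟨$⟩ʳ σ zero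
    ρ≢πσ₀ eq with () ← σ-inj (permutation-injective π (trans (π∘σ≡ρ t) eq))
    ρ≢ρ₀ : ρ (suc t) ≢ ρ zero
    ρ≢ρ₀ eq with () ← ρ-inj eq

module _ {n r : ℕ} (G : Graph n) (h : ℕ → ℕ → Bool) (h-bounded : ∀ p q → h p q ≡ true → p < r × q < r)
         (σ : Fin r → Fin n) (σ-inj : ∀ {s t} → σ s ≡ σ t → s ≡ t) (r≤n : r ≤ n)
         (adj⇒image : ∀ i j → adj G i j ≡ true →
                      Σ (Fin r) λ s → Σ (Fin r) λ t → i ≡ σ s × j ≡ σ t × h (toℕ s) (toℕ t) ≡ true)
         (image⇒adj : ∀ s t → h (toℕ s) (toℕ t) ≡ true → adj G (σ s) (σ t) ≡ true) where

  private
    ι : Fin r → Fin n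
    ι t = inject≤ t r≤n

    ι-inj : ∀ {s t} → ι s ≡ ι t → s ≡ t
    ι-inj {s} {t} eq = toℕ-injective (trans (sym (toℕ-inject≤ s r≤n)) (trans (cong toℕ eq) (toℕ-inject≤ t r≤n)))

    π : Permutation′ n
    π = proj₁ (injections-permutation r σ ι σ-inj ι-inj)

    π∘σ≡ι : ∀ t → π ⟨$⟩ʳ σ t ≡ ι t
    π∘σ≡ι = proj₂ (injections-permutation r σ ι σ-inj ι-inj)

    toℕ-π∘σ : ∀ s → toℕ (π ⟨$⟩ʳ σ s) ≡ toℕ s
    toℕ-π∘σ s = trans (cong toℕ (π∘σ≡ι s)) (toℕ-inject≤ s r≤n)

    σ-fromℕ< : ∀ i (p : toℕ (π ⟨$⟩ʳ i) < r) → σ (fromℕ< p) ≡ i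
    σ-fromℕ< i p = permutation-injective π (trans (π∘σ≡ι (fromℕ< p))
                     (toℕ-injective (trans (toℕ-inject≤ (fromℕ< p) r≤n) (toℕ-fromℕ< p))))

  -- π moves the embedded copy σ(Fin r) onto the first r vertices.
  embedding⇒isomorphism : Σ (Permutation′ n) λ π → ∀ i j → adj G i j ≡ h (toℕ (π ⟨$⟩ʳ i)) (toℕ (π ⟨$⟩ʳ j))
  embedding⇒isomorphism = π , λ i j → ⇔→≡ {z = true} (mk⇔ (forth i j) (back i j))
    where
    forth : ∀ i j → adj G i j ≡ true → h (toℕ (π ⟨$⟩ʳ i)) (toℕ (π ⟨$⟩ʳ j)) ≡ true
    forth i j adj≡true with adj⇒image i j adj≡true
    ... | s , t , refl , refl , h≡true = subst₂ (λ p q → h p q ≡ true) (sym (toℕ-π∘σ s)) (sym (toℕ-π∘σ t)) h≡true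
    back : ∀ i j → h (toℕ (π ⟨$⟩ʳ i)) (toℕ (π ⟨$⟩ʳ j)) ≡ true → adj G i j ≡ true
    back i j h≡true with h-bounded _ _ h≡true
    ... | pᵢ , pⱼ = subst₂ (λ a b → adj G a b ≡ true) (σ-fromℕ< i pᵢ) (σ-fromℕ< j pⱼ)
                      (image⇒adj (fromℕ< pᵢ) (fromℕ< pⱼ)
                        (subst₂ (λ p q → h p q ≡ true) (sym (toℕ-fromℕ< pᵢ)) (sym (toℕ-fromℕ< pⱼ)) h≡true))

SamePair : ∀ {A : Set} → A × A → A × A → Set
SamePair (s , t) (s′ , t′) = (s ≡ s′ × t ≡ t′) ⊎ (s ≡ t′ × t ≡ s′)

samePair? : ∀ {r} → Decidable₂ (SamePair {Fin r})
samePair? (s , t) (s′ , t′) = ((s ≟ᶠ s′) ×-dec (t ≟ᶠ t′)) ⊎-dec ((s ≟ᶠ t′) ×-dec (t ≟ᶠ s′))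

record Template (r : ℕ) (h : ℕ → ℕ → Bool) : Set where
  field
    edgeList : List (Edge r)
    sound : All (λ (s , t) → h (toℕ s) (toℕ t) ≡ true) edgeList
    complete : ∀ s t → h (toℕ s) (toℕ t) ≡ true → (s , t) ∈ edgeList ⊎ (t , s) ∈ edgeList
    distinct : AllPairs (λ p q → ¬ SamePair p q) edgeList

template-complete? : ∀ {r} (h : ℕ → ℕ → Bool) (T : List (Edge r)) →
                     Dec (∀ s t → h (toℕ s) (toℕ t) ≡ true → (s , t) ∈ T ⊎ (t , s) ∈ T)
template-complete? {r} h T = all? λ s → all? λ t → (h (toℕ s) (toℕ t) ≟ᵇ true) →-dec ((s , t) ∈? T ⊎-dec (t , s) ∈? T)
  where open DecMembership (_≟ₑ_ {r}) using (_∈?_)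

template-distinct? : ∀ {r} (T : List (Edge r)) → Dec (AllPairs (λ p q → ¬ SamePair p q) T)
template-distinct? T = allPairs? (λ p q → ¬? (samePair? p q)) T

module _ {n r : ℕ} (G : Graph n) {h : ℕ → ℕ → Bool} (h-sym : ∀ p q → h p q ≡ h q p) (h-bounded : ∀ p q → h p q ≡ true → p < r)
         (T : Template r h) (σ : Fin r → Fin n) (σ-inj : ∀ {s t} → σ s ≡ σ t → s ≡ t) (r≤n : r ≤ n)
         (embeds : All (λ (s , t) → Adj (edges G) (σ s) (σ t)) (Template.edgeList T))
         (few : length (edges G) ≤ length (Template.edgeList T)) where

  open Template T

  private
    image : Edge r → Edge n
    image (s , t) = edgeBetween (σ s) (σ t)

    images : List (Edge n)
    images = map image edgeList

    images⊆edges : images ⊆ edges G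
    images⊆edges e∈ with (s , t) , st∈ , refl ← ∈-map⁻ image e∈ =
      edgeBetween∈edges G (Adj⇒adj G (All.lookup embeds st∈))

    image-injective : ∀ {p q} → image p ≡ image q → SamePair p q
    image-injective {s , t} {s′ , t′} eq
      with joins-unique (edgeBetween-joins (σ s) (σ t))
                        (subst (λ e → Joins e (σ s′) (σ t′)) (sym eq) (edgeBetween-joins (σ s′) (σ t′)))
    ... | inj₁ (σs≡ , σt≡) = inj₁ (σ-inj σs≡ , σ-inj σt≡)
    ... | inj₂ (σs≡ , σt≡) = inj₂ (σ-inj σs≡ , σ-inj σt≡)

    images-unique : Unique images
    images-unique = AllPairsₚ.map⁺ (AllPairs.map (λ ¬same eq → ¬same (image-injective eq)) distinct)

    -- G has no more edges than the template, so the images are all of them.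
    edges⊆images : edges G ⊆ images
    edges⊆images = unique-⊆-length≥⇒⊇ _≟ₑ_ images⊆edges images-unique
                     (subst (length (edges G) ≤_) (sym (length-map image edgeList)) few)

    adj⇒image : ∀ i j → adj G i j ≡ true → Σ (Fin r) λ s → Σ (Fin r) λ t → i ≡ σ s × j ≡ σ t × h (toℕ s) (toℕ t) ≡ true
    adj⇒image i j adj≡true with Adj⇒Joins (adj⇒Adj G adj≡true)
    ... | e , e∈ , e-ij with ∈-map⁻ image (edges⊆images e∈)
    ...   | (s , t) , st∈ , refl with joins-unique e-ij (edgeBetween-joins (σ s) (σ t))
    ...     | inj₁ (i≡ , j≡) = s , t , i≡ , j≡ , All.lookup sound st∈
    ...     | inj₂ (i≡ , j≡) = t , s , i≡ , j≡ , trans (h-sym (toℕ t) (toℕ s)) (All.lookup sound st∈)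

    image⇒adj : ∀ s t → h (toℕ s) (toℕ t) ≡ true → adj G (σ s) (σ t) ≡ true
    image⇒adj s t h≡true with complete s t h≡true
    ... | inj₁ st∈ = Adj⇒adj G (All.lookup embeds st∈)
    ... | inj₂ ts∈ = Adj⇒adj G (Adj-sym (All.lookup embeds ts∈))

  template-isomorphism : Σ (Permutation′ n) λ π → ∀ i j → adj G i j ≡ h (toℕ (π ⟨$⟩ʳ i)) (toℕ (π ⟨$⟩ʳ j))
  template-isomorphism = embedding⇒isomorphism G h bounded σ σ-inj r≤n adj⇒image image⇒adj
    where
    bounded : ∀ p q → h p q ≡ true → p < r × q < r
    bounded p q h≡true = h-bounded p q h≡true , h-bounded q p (trans (h-sym q p) h≡true)

private
  tri-bounded : ∀ p q → tri p q ≡ true → p < 3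
  tri-bounded 0 _ _ = s≤s z≤n
  tri-bounded 1 _ _ = s≤s (s≤s z≤n)
  tri-bounded 2 _ _ = s≤s (s≤s (s≤s z≤n))
  tri-bounded (suc (suc (suc _))) _ ()

  triEdge-bounded : ∀ p q → triEdge p q ≡ true → p < 5
  triEdge-bounded 0 _ _ = s≤s z≤n
  triEdge-bounded 1 _ _ = s≤s (s≤s z≤n)
  triEdge-bounded 2 _ _ = s≤s (s≤s (s≤s z≤n))
  triEdge-bounded 3 _ _ = s≤s (s≤s (s≤s (s≤s z≤n)))
  triEdge-bounded 4 _ _ = s≤s (s≤s (s≤s (s≤s (s≤s z≤n))))
  triEdge-bounded (suc (suc (suc (suc (suc _))))) _ ()

  K₃-edges : List (Edge 3)
  K₃-edges = (# 0 , # 1) ∷ (# 1 , # 2) ∷ (# 0 , # 2) ∷ []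

  K₃-template : Template 3 tri
  K₃-template = record
    { edgeList = K₃-edges
    ; sound = refl ∷ refl ∷ refl ∷ []
    ; complete = from-yes (template-complete? tri K₃-edges)
    ; distinct = from-yes (template-distinct? K₃-edges) }

  K₃∪K₂-edges : List (Edge 5)
  K₃∪K₂-edges = (# 0 , # 1) ∷ (# 1 , # 2) ∷ (# 0 , # 2) ∷ (# 3 , # 4) ∷ []

  K₃∪K₂-template : Template 5 triEdge
  K₃∪K₂-template = record
    { edgeList = K₃∪K₂-edges
    ; sound = refl ∷ refl ∷ refl ∷ refl ∷ []
    ; complete = from-yes (template-complete? triEdge K₃∪K₂-edges)
    ; distinct = from-yes (template-distinct? K₃∪K₂-edges) }

module _ {n : ℕ} (G : Graph n) where

  private
    ≤n : ∀ {vs : List (Fin n)} → Unique vs → length vs ≤ n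
    ≤n {vs} distinct = subst (length vs ≤_) (length-tabulate (λ i → i)) (unique-⊆⇒length≤ distinct (λ {z} _ → ∈-allFin z))

  K₃⇒≅ : IsK₃ (edges G) → 3 ≤ n × G ≅ K3∪K1s n
  K₃⇒≅ (a , b , c , (distinct , ab , bc , ac) , |E|≡3) =
    ≤n distinct ,
    template-isomorphism G tri-sym tri-bounded K₃-template (lookup (a ∷ b ∷ c ∷ [])) (unique-lookup-injective distinct)
      (≤n distinct) (ab ∷ bc ∷ ac ∷ []) (≤-reflexive |E|≡3)

  K₃∪K₂⇒≅ : IsK₃∪K₂ (edges G) → 5 ≤ n × G ≅ K3∪K2∪K1s n
  K₃∪K₂⇒≅ (a , b , c , x , y , distinct , ab , bc , ac , xy , |E|≡4) =
    ≤n distinct ,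
    template-isomorphism G triEdge-sym triEdge-bounded K₃∪K₂-template (lookup (a ∷ b ∷ c ∷ x ∷ y ∷ [])) (unique-lookup-injective distinct)
      (≤n distinct) (ab ∷ bc ∷ ac ∷ xy ∷ []) (≤-reflexive |E|≡4)

-- Upper bounds and the theorem

edgesOf-length : ∀ {n} (ps : List (Edge n × Edge n)) → length (edgesOf ps) ≡ 2 * length ps
edgesOf-length [] = refl
edgesOf-length (_ ∷ ps) = trans (cong (λ l → suc (suc l)) (edgesOf-length ps)) (sym (*-distribˡ-+ 2 1 (length ps)))

module _ {n : ℕ} (G : Graph n) where

  private
    m : ℕ
    m = numEdges G

    edgePair⇒In : ∀ {p} → IsEdgePair G p → EdgePairIn (edges G) p
    edgePair⇒In {(i , j) , (k , l)} (e , f , e⊥f) = ∈edges⁺ G e , ∈edges⁺ G f , e⊥f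

    edgesOf⊆ : ∀ {ps} → All (IsEdgePair G) ps → All (_∈ edges G) (edgesOf ps)
    edgesOf⊆ ps∈ = edgesOf-⊆ (All.map edgePair⇒In ps∈)

  2*size≤numEdges : ∀ {ps} → IsDisjointFamily G ps → 2 * length ps ≤ m
  2*size≤numEdges {ps} (ps∈ , unique) = subst (_≤ m) (edgesOf-length ps) (unique-⊆⇒length≤ unique (All.lookup (edgesOf⊆ ps∈)))

  private
    -- From each pair, an edge missing v: independent edges cannot both meet v.
    missing : Fin n → List (Edge n × Edge n) → List (Edge n)
    missing v [] = []
    missing v ((e , f) ∷ ps) with incident? v e
    ... | yes _ = f ∷ missing v ps
    ... | no _ = e ∷ missing v ps

    missing-length : ∀ v ps → length (missing v ps) ≡ length ps
    missing-length v [] = refl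
    missing-length v ((e , f) ∷ ps) with incident? v e
    ... | yes _ = cong suc (missing-length v ps)
    ... | no _ = cong suc (missing-length v ps)

    ∈-missing : ∀ v {ps} → All (IsEdgePair G) ps → ∀ {g} → g ∈ missing v ps → g ∈ edgesOf ps × ¬ Incident v g
    ∈-missing v {(e , f) ∷ ps} ((_ , _ , e⊥f) ∷ ps∈) g∈ with incident? v e | g∈
    ... | yes ve | here refl = there (here refl) , independent⇒¬shared e⊥f ve
    ... | no ¬ve | here refl = here refl , ¬ve
    ... | yes _ | there g∈′ = let g∈ps , ¬vg = ∈-missing v ps∈ g∈′ in there (there g∈ps) , ¬vg
    ... | no _ | there g∈′ = let g∈ps , ¬vg = ∈-missing v ps∈ g∈′ in there (there g∈ps) , ¬vg

    missing-unique : ∀ v {ps} → All (IsEdgePair G) ps → Unique (edgesOf ps) → Unique (missing v ps)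
    missing-unique v {[]} [] _ = []
    missing-unique v {(e , f) ∷ ps} (_ ∷ ps∈) ((_ ∷ e∉) ∷ f∉ ∷ unique) with incident? v e
    ... | yes _ = All.tabulate (λ g∈ → All.lookup f∉ (proj₁ (∈-missing v ps∈ g∈))) ∷ missing-unique v ps∈ unique
    ... | no _ = All.tabulate (λ g∈ → All.lookup e∉ (proj₁ (∈-missing v ps∈ g∈))) ∷ missing-unique v ps∈ unique

  -- One edge of each pair misses v, and none of those is among the deg v edges at v.
  size+deg≤numEdges : ∀ v {ps} → IsDisjointFamily G ps → length ps + deg (edges G) v ≤ m
  size+deg≤numEdges v {ps} (ps∈ , unique) =
    subst (_≤ m) (trans (length-++ (missing v ps)) (cong (_+ deg (edges G) v) (missing-length v ps)))
      (unique-⊆⇒length≤ (Unique.++⁺ (missing-unique v ps∈ unique) (Unique.filter⁺ (incident? v) (proj₂ (edges-simple G))) disjoint) ⊆edges)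
    where
    disjoint : ∀ {g} → ¬ (g ∈ missing v ps × g ∈ filter (incident? v) (edges G))
    disjoint (g∈ , g∈′) = proj₂ (∈-missing v ps∈ g∈) (proj₂ (∈-filter⁻ (incident? v) {xs = edges G} g∈′))
    ⊆edges : ∀ {g} → g ∈ missing v ps ++ filter (incident? v) (edges G) → g ∈ edges G
    ⊆edges g∈ with ∈-++⁻ (missing v ps) g∈
    ... | inj₁ g∈₁ = All.lookup (edgesOf⊆ ps∈) (proj₁ (∈-missing v ps∈ g∈₁))
    ... | inj₂ g∈₂ = proj₁ (∈-filter⁻ (incident? v) {xs = edges G} g∈₂)

private
  2*n≤m⇒n≤m/2 : ∀ a m → 2 * a ≤ m → a ≤ m / 2
  2*n≤m⇒n≤m/2 a m 2a≤m = subst (_≤ m / 2) (m*n/n≡m a 2) (/-monoˡ-≤ 2 (subst (_≤ m) (*-comm 2 a) 2a≤m))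

  2*[m/2]≤m : ∀ m → 2 * (m / 2) ≤ m
  2*[m/2]≤m m = subst (_≤ m) (*-comm (m / 2) 2) (m/n*n≤m m 2)

module _ {n : ℕ} (G : Graph n) (¬K₃ : 3 ≤ n → ¬ (G ≅ K3∪K1s n)) (¬K₃∪K₂ : 5 ≤ n → ¬ (G ≅ K3∪K2∪K1s n)) where

  private
    m Δ : ℕ
    m = numEdges G
    Δ = maxDegree G

    In⇒edgePair : ∀ {p} → EdgePairIn (edges G) p → IsEdgePair G p
    In⇒edgePair (e∈ , f∈ , e⊥f) = ∈edges⁻ G e∈ , ∈edges⁻ G f∈ , e⊥f

  family-of-size : ∀ k → 2 * k ≤ m → (∀ v → deg (edges G) v + k ≤ m) →
                   Σ (List (Edge n × Edge n)) λ ps → IsDisjointFamily G ps × length ps ≡ k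
  family-of-size k 2k≤m deg≤ with packing-or-exceptional k (edges-simple G) 2k≤m deg≤
  ... | inj₁ (inj₁ (_ , K₃)) = ⊥-elim (uncurry ¬K₃ (K₃⇒≅ G K₃))
  ... | inj₁ (inj₂ (_ , K₃∪K₂)) = ⊥-elim (uncurry ¬K₃∪K₂ (K₃∪K₂⇒≅ G K₃∪K₂))
  ... | inj₂ (ps , ps∈ , unique , |ps|≡k) = ps , (All.map In⇒edgePair ps∈ , unique) , |ps|≡k

  dense-case : 2 * Δ ≤ m → IsMaxEdgePairNumber G (m / 2)
  dense-case 2Δ≤m = family-of-size (m / 2) (2*[m/2]≤m m) deg+m/2≤m ,
                    λ ps family → 2*n≤m⇒n≤m/2 (length ps) m (2*size≤numEdges G family)
    where
    deg+m/2≤m : ∀ v → deg (edges G) v + m / 2 ≤ m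
    deg+m/2≤m v = ≤-trans (+-monoˡ-≤ (m / 2) (≤-trans (deg≤maxDegree G v) (2*n≤m⇒n≤m/2 Δ m 2Δ≤m)))
                          (subst (_≤ m) (2*n≡n+n (m / 2)) (2*[m/2]≤m m))

  sparse-case : m < 2 * Δ → IsMaxEdgePairNumber G (m ∸ Δ)
  sparse-case m<2Δ with maxDegree-attained G
  ... | inj₁ Δ≡0 = ⊥-elim (<-irrefl refl (≤-trans (s≤s z≤n) (≤-trans m<2Δ (≤-reflexive (cong (2 *_) Δ≡0)))))
  ... | inj₂ (u , du≡Δ) = family-of-size (m ∸ Δ) 2[m∸Δ]≤m deg+[m∸Δ]≤m ,
                          λ ps family → m+n≤o⇒m≤o∸n (length ps) (subst (λ d → length ps + d ≤ m) du≡Δ (size+deg≤numEdges G u family))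
    where
    Δ≤m : Δ ≤ m
    Δ≤m = subst (_≤ m) du≡Δ (length-filter _ (edges G))
    m∸Δ≤Δ : m ∸ Δ ≤ Δ
    m∸Δ≤Δ = ≤-trans (∸-monoˡ-≤ Δ (≤-trans (<⇒≤ m<2Δ) (≤-reflexive (2*n≡n+n Δ)))) (≤-reflexive (m+n∸n≡m Δ Δ))
    2[m∸Δ]≤m : 2 * (m ∸ Δ) ≤ m
    2[m∸Δ]≤m = ≤-trans (≤-reflexive (2*n≡n+n (m ∸ Δ))) (≤-trans (+-monoʳ-≤ (m ∸ Δ) m∸Δ≤Δ) (≤-reflexive (m∸n+n≡m Δ≤m)))
    deg+[m∸Δ]≤m : ∀ v → deg (edges G) v + (m ∸ Δ) ≤ m
    deg+[m∸Δ]≤m v = ≤-trans (+-monoˡ-≤ (m ∸ Δ) (deg≤maxDegree G v)) (≤-reflexive (trans (+-comm Δ (m ∸ Δ)) (m∸n+n≡m Δ≤m)))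

theorem8 : (n : ℕ) (G : Graph n) →
    (3 ≤ n → ¬ (G ≅ K3∪K1s n)) →
    (5 ≤ n → ¬ (G ≅ K3∪K2∪K1s n)) →
    (2 * maxDegree G ≤ numEdges G → IsMaxEdgePairNumber G (numEdges G / 2)) ×
    (numEdges G < 2 * maxDegree G → IsMaxEdgePairNumber G (numEdges G ∸ maxDegree G))
theorem8 n G ¬K₃ ¬K₃∪K₂ = dense-case G ¬K₃ ¬K₃∪K₂ , sparse-case G ¬K₃ ¬K₃∪K₂
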